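{- Let $s\geq 2$ be even, let $V=\mathbf{Z}/(2s+1)\mathbf{Z}\times \mathbf{Z}/3\mathbf{Z}$, and let $B(s)$ and $T$ be as in the context. The simplicial complex $B(s)\cup B(s)^T$ (an orientable closed combinatorial surface on the vertex set $V$) has genus $\frac{1}{2}s(6s-1)$, $1$-chromatic number $\chi_1(B(s)\cup B(s)^T)=3(2s+1)$ and $2$-chromatic number $\chi_2(B(s)\cup B(s)^T)=3$. Moreover, the horizontal shift $h(x,y)=(x+1,y)$ is an orientation preserving automorphism of $B(s)\cup B(s)^T$.
   Context: In $\mathbf{Z}/(2s+1)\mathbf{Z}$, $2$ is invertible ($2^{ -1}=s+1$). The Bose Steiner triple system $B(s)$ on $V$ consists of the triples $\{x\}\times \mathbf{Z}/3\mathbf{Z}$ for $x\in \mathbf{Z}/(2s+1)\mathbf{Z}$ together with the triples $\{(x_1,y),(x_2,y),((x_1+x_2)/2,y+1)\}$ for $x_1\neq x_2$ in $\mathbf{Z}/(2s+1)\mathbf{Z}$ and $y\in\mathbf{Z}/3\mathbf{Z}$. The permutation $T$ of $V$ is $(x,0)\mapsto(x,0)$, $(x,1)\mapsto(x+1,2)$, $(x,2)\mapsto(x+1,1)$, and $B(s)^T=\{\{a^T,b^T,c^T\}\mid\{a,b,c\}\in B(s)\}$; $B(s)\cup B(s)^T$ is the simplicial complex generated by both sets of triangles. It is known that $B(s)\cup B(s)^T$ is an orientable combinatorial surface. For a simplicial complex $K$, $\chi_1(K)$ is the chromatic number of its $1$-skeleton and $\chi_2(K)$ is the minimal number of colors needed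 to color the vertices so that no triangle is monochromatic. -}

module Defs where

open import Data.Nat using (ℕ; zero; suc; _+_; _*_; _∸_; _<_; NonZero)
open import Data.Nat.DivMod using (_mod_; _/_)
open import Data.Fin using (Fin; toℕ) renaming (zero to f0; suc to fs)
open import Data.Fin.Properties as FinP using ()
open import Data.Sum using (_⊎_)
open import Data.Product using (_×_; _,_; proj₁; proj₂; Σ)
open import Data.Product.Properties using (≡-dec)
open import Data.Bool using (Bool; true; false; _∧_; _∨_; not; T)
open import Data.List using (List; allFin; cartesianProduct; filter; length; map)
open import Data.Bool.ListAction using (any)
open import Relation.Nullary using (¬_)
open import Relation.Nullary.Decidable using (⌊_⌋)
open import Relation.Binary.PropositionalEquality using (_≡_)
open import Function using (_∘_)

N : ℕ → ℕ
N s = suc (2 * s)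

ZN : ℕ → Set
ZN s = Fin (N s)

addN : ∀ s → ZN s → ZN s → ZN s
addN s a b = (toℕ a + toℕ b) mod N s

oneN : ∀ s → ZN s
oneN s = 1 mod N s

-- (x₁ + x₂)/2 in Z/(2s+1)Z, using 2⁻¹ = s+1
halfSum : ∀ s → ZN s → ZN s → ZN s
halfSum s a b = ((toℕ a + toℕ b) * (s + 1)) mod N s

add3 : Fin 3 → Fin 3 → Fin 3
add3 a b = (toℕ a + toℕ b) mod 3

one3 two3 : Fin 3
one3 = fs f0
two3 = fs (fs f0)

V : ℕ → Set
V s = ZN s × Fin 3

allV : ∀ s → List (V s)
allV s = cartesianProduct (allFin (N s)) (allFin 3)

_=V_ : ∀ {n} → Fin n × Fin 3 → Fin n × Fin 3 → Bool
_=V_ a b = ⌊ ≡-dec FinP._≟_ FinP._≟_ a b ⌋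

-- {a,b,c} = {p,q,r} as sets of three (possibly coinciding) points,
-- where the right side is given as an ordered triple; we require distinctness
-- separately where needed.
samePerm : ∀ {n} → (a b c p q r : Fin n × Fin 3) → Bool
samePerm a b c p q r =
     (a =V p ∧ b =V q ∧ c =V r) ∨ (a =V p ∧ b =V r ∧ c =V q)
  ∨ (a =V q ∧ b =V p ∧ c =V r) ∨ (a =V q ∧ b =V r ∧ c =V p)
  ∨ (a =V r ∧ b =V p ∧ c =V q) ∨ (a =V r ∧ b =V q ∧ c =V p)

-- The Bose Steiner triple system B(s): (a,b,c) lists a triple of B(s)
-- (in any order).

inB : ∀ s → V s → V s → V s → Bool
inB s a b c =
     any (λ x → samePerm a b c (x , f0) (x , one3) (x , two3)) (allFin (N s))
  ∨ any (λ x₁ → any (λ x₂ → any (λ y →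
          not ⌊ x₁ FinP.≟ x₂ ⌋ ∧
          samePerm a b c (x₁ , y) (x₂ , y) (halfSum s x₁ x₂ , add3 y one3))
        (allFin 3)) (allFin (N s))) (allFin (N s))

Tperm : ∀ s → V s → V s
Tperm s (x , f0)           = (x , f0)
Tperm s (x , fs f0)        = (addN s x (oneN s) , two3)
Tperm s (x , fs (fs f0))   = (addN s x (oneN s) , one3)

inBT : ∀ s → V s → V s → V s → Bool
inBT s a b c =
  any (λ p → any (λ q → any (λ r →
        inB s p q r ∧ samePerm a b c (Tperm s p) (Tperm s q) (Tperm s r))
      (allV s)) (allV s)) (allV s)

faceB : ∀ s → V s → V s → V s → Bool
faceB s a b c = inB s a b c ∨ inBT s a b c

Face : ∀ s → V s → V s → V s → Set
Face s a b c = T (faceB s a b c)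

edgeB : ∀ s → V s → V s → Bool
edgeB s a b = not (a =V b) ∧ any (λ c → faceB s a b c) (allV s)

Edge : ∀ s → V s → V s → Set
Edge s a b = T (edgeB s a b)

count : ∀ {A : Set} → (A → Bool) → List A → ℕ
count p xs = length (filter (λ x → T? (p x)) xs)
  where
    open import Data.Bool.Properties using (T?)

numVertices : ℕ → ℕ
numVertices s = length (allV s)

-- each edge {a,b} is counted twice as an ordered pair
numEdges : ℕ → ℕ
numEdges s =
  count (λ ab → edgeB s (proj₁ ab) (proj₂ ab)) (cartesianProduct (allV s) (allV s)) / 2

-- each triangle {a,b,c} (three distinct vertices) is counted 6 times as an ordered triple
numFaces : ℕ → ℕ
numFaces s =
  count (λ abc → faceB s (proj₁ abc) (proj₁ (proj₂ abc)) (proj₂ (proj₂ abc)))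
        (cartesianProduct (allV s) (cartesianProduct (allV s) (allV s))) / 6

-- Genus of the closed orientable surface K(s): χ = V − E + F = 2 − 2g,
-- i.e. g = (2 + E − V − F)/2.
genus : ℕ → ℕ
genus s = ((2 + numEdges s) ∸ (numVertices s + numFaces s)) / 2

Proper1 : ℕ → ℕ → Set
Proper1 s k = Σ (V s → Fin k) λ col → ∀ a b → Edge s a b → ¬ (col a ≡ col b)

Proper2 : ℕ → ℕ → Set
Proper2 s k = Σ (V s → Fin k) λ col →
  ∀ a b c → Face s a b c → ¬ ((col a ≡ col b) × (col b ≡ col c))

IsMinimum : (ℕ → Set) → ℕ → Set
IsMinimum P k = P k × (∀ j → j < k → ¬ P j)

chi1Is : ℕ → ℕ → Set
chi1Is s k = IsMinimum (Proper1 s) k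

chi2Is : ℕ → ℕ → Set
chi2Is s k = IsMinimum (Proper2 s) k

-- An orientation: a set O of ordered triangles (a,b,c) such that
--  * O only contains triangles of K(s);
--  * O is closed under cyclic rotation;
--  * every triangle has exactly one of its two cyclic orders in O;
--  * coherence: every directed edge (a,b) occurs in at most one oriented
--    triangle (so adjacent triangles induce opposite orientations on
--    their common edge).
-- (Stated as an iterated product rather than a record to keep the
-- positivity checker from unfolding the large Face predicate.)
Orientation : (s : ℕ) → (V s → V s → V s → Set) → Set
Orientation s O =
    (∀ a b c → O a b c → Face s a b c)
  × (∀ a b c → O a b c → O b c a)
  × (∀ a b c → Face s a b c → O a b c ⊎ O a c b)
  × (∀ a b c → O a b c → ¬ O a c b)
  × (∀ a b c d → O a b c → O a b d → c ≡ d)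

hshift : ∀ s → V s → V s
hshift s (x , y) = (addN s x (oneN s) , y)

IsAutomorphism : ∀ s → (V s → V s) → Set
IsAutomorphism s f =
    Σ (V s → V s) (λ g → (∀ v → g (f v) ≡ v) × (∀ v → f (g v) ≡ v))
  × (∀ a b c → Face s a b c → Face s (f a) (f b) (f c))
  × (∀ a b c → Face s (f a) (f b) (f c) → Face s a b c)

-- f preserves (some, hence - K(s) being connected - every) orientation
OrientationPreserving : ∀ s → (V s → V s) → Set₁
OrientationPreserving s f =
  Σ (V s → V s → V s → Set) λ O → Orientation s O ×
    (∀ a b c → O a b c → O (f a) (f b) (f c))

-- B(s) is a Steiner triple system on v = 6s + 3 points, and so is its image under T; for every pair
-- {a, b} the triangles of B(s) and of B(s)ᵀ through it have different third vertices.  So every pair of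
-- vertices is an edge and lies in exactly two triangles: E = v(v − 1)/2 and F = v(v − 1)/3, which gives
-- the genus by Euler's formula, and the 1-skeleton is complete, so χ₁ = v.  Colouring a vertex by its
-- level y separates every triangle, while no Steiner triple system on more than four points is
-- 2-colourable (double counting of two-coloured pairs), so χ₂ = 3.  The shift commutes with T and
-- with the midpoint and reflection maps defining B(s).  Orienting, for each pair (a, b), the B(s)-
-- triangle as (a, b, c) or as (b, a, c) according to the levels of a, b and the parity of the
-- representative of x_b − x_a in [0, 2s] gives a coherent orientation, and it is shift invariant.

module Submission where

open import Defs
open import Data.Nat using (ℕ; _*_; _+_; _∸_; _≤_)
open import Data.Nat.DivMod using (_/_)
open import Data.Nat.Divisibility using (_∣_)
open import Data.Product using (_×_)
open import Relation.Binary.PropositionalEquality using (_≡_)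
open import Data.Nat using (zero; suc; _<_; z≤n; s≤s; NonZero)
open import Data.Nat.Properties
open import Data.Nat.DivMod using (_%_; _mod_; %-distribˡ-+; %-distribˡ-*; [m+kn]%n≡m%n; m%n%n≡m%n; m%n<n; m<n⇒m%n≡m; m*n/n≡m)
open import Data.Nat.Tactic.RingSolver using (solve-∀)
open import Data.Fin using (Fin; toℕ; inject≤) renaming (zero to f0; suc to fs)
import Data.Fin
import Data.Fin.Properties as FP
open import Data.Product using (_,_; proj₁; proj₂; ∃; ∃₂)
open import Data.Product.Properties using (≡-dec)
open import Data.Sum using (_⊎_; inj₁; inj₂; [_,_]′)
import Data.Sum
open import Data.Bool using (Bool; true; false; _∧_; _∨_; not; _xor_; T)
open import Data.Bool.Properties using (T?; T-≡; T-not-≡; T-∨; T-∧; not-involutive)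
open import Data.Bool.ListAction using (any)
open import Data.List using (List; []; _∷_; _++_; map; length; filter; cartesianProduct; allFin; tabulate)
open import Data.List.Properties using (length-tabulate)
open import Data.List.Membership.Propositional using (_∈_; lose)
open import Data.List.Membership.Propositional.Properties using (∈-allFin; ∈-cartesianProduct⁺)
open import Data.List.Relation.Unary.Any using (satisfied)
open import Data.List.Relation.Unary.Any.Properties using (any⁺; any⁻)
open import Data.Empty using (⊥; ⊥-elim)
open import Function using (_∘_; _↔_; Inverse; _⇔_; mk⇔; Equivalence)
open import Relation.Nullary using (¬_; Dec; yes; no; _×-dec_)
open import Relation.Nullary.Decidable
  using (⌊_⌋; isYes≗does; does-⇔; dec-true; dec-false; toWitness; fromWitness; toWitnessFalse; fromWitnessFalse)
open import Relation.Binary.Definitions using (DecidableEquality)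
open import Relation.Binary.PropositionalEquality hiding ([_])

-- Arithmetic modulo 2s + 1

module Congruence (n : ℕ) .{{_ : NonZero n}} where

  infix 4 _≈_

  -- A record rather than a synonym, so that a and b can be inferred from a proof.
  record _≈_ (a b : ℕ) : Set where
    constructor mk≈
    field %-≡ : a % n ≡ b % n

  open _≈_ public

  ≈-refl : ∀ {a} → a ≈ a
  ≈-refl = mk≈ refl

  ≈-sym : ∀ {a b} → a ≈ b → b ≈ a
  ≈-sym (mk≈ e) = mk≈ (sym e)

  ≈-trans : ∀ {a b c} → a ≈ b → b ≈ c → a ≈ c
  ≈-trans (mk≈ e) (mk≈ f) = mk≈ (trans e f)

  ≈-reflexive : ∀ {a b} → a ≡ b → a ≈ b
  ≈-reflexive refl = ≈-refl

  %-≈ : ∀ a → a % n ≈ a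
  %-≈ a = mk≈ (m%n%n≡m%n a n)

  +-cong : ∀ {a b c d} → a ≈ b → c ≈ d → a + c ≈ b + d
  +-cong {a} {b} {c} {d} (mk≈ e) (mk≈ f) = mk≈ (begin
    (a + c) % n           ≡⟨ %-distribˡ-+ a c n ⟩
    (a % n + c % n) % n   ≡⟨ cong₂ (λ u v → (u + v) % n) e f ⟩
    (b % n + d % n) % n   ≡⟨ %-distribˡ-+ b d n ⟨
    (b + d) % n           ∎)
    where open ≡-Reasoning

  *-cong : ∀ {a b c d} → a ≈ b → c ≈ d → a * c ≈ b * d
  *-cong {a} {b} {c} {d} (mk≈ e) (mk≈ f) = mk≈ (begin
    (a * c) % n               ≡⟨ %-distribˡ-* a c n ⟩
    (a % n * (c % n)) % n     ≡⟨ cong₂ (λ u v → (u * v) % n) e f ⟩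
    (b % n * (d % n)) % n     ≡⟨ %-distribˡ-* b d n ⟨
    (b * d) % n               ∎)
    where open ≡-Reasoning

  +-congˡ : ∀ {a b} c → a ≈ b → c + a ≈ c + b
  +-congˡ c = +-cong (≈-refl {c})

  +-congʳ : ∀ {a b} c → a ≈ b → a + c ≈ b + c
  +-congʳ c e = +-cong e (≈-refl {c})

  *-congˡ : ∀ {a b} c → a ≈ b → c * a ≈ c * b
  *-congˡ c = *-cong (≈-refl {c})

  *-congʳ : ∀ {a b} c → a ≈ b → a * c ≈ b * c
  *-congʳ c e = *-cong e (≈-refl {c})

  ≈-by-multiples : ∀ {a b} k l → a + k * n ≡ b + l * n → a ≈ b
  ≈-by-multiples {a} {b} k l e =
    mk≈ (trans (sym ([m+kn]%n≡m%n a k n)) (trans (cong (_% n) e) ([m+kn]%n≡m%n b l n)))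

  ≈⇒≡ : ∀ {a b} → a < n → b < n → a ≈ b → a ≡ b
  ≈⇒≡ a<n b<n (mk≈ e) = trans (sym (m<n⇒m%n≡m a<n)) (trans e (m<n⇒m%n≡m b<n))

a+a≡2a : ∀ a → a + a ≡ 2 * a
a+a≡2a a = cong (a +_) (sym (+-identityʳ a))

-- −x is represented by 2s·x and x/2 by (s + 1)·x
module Zmod (s : ℕ) where

  open Congruence (N s) public

  n : ℕ
  n = N s

  [_] : ℕ → ZN s
  [ a ] = a mod n

  toℕ-[] : ∀ a → toℕ [ a ] ≈ a
  toℕ-[] a = ≈-trans (≈-reflexive (FP.toℕ-fromℕ< (m%n<n a n))) (%-≈ a)

  ≈⇒≡ᶻ : ∀ {x y : ZN s} → toℕ x ≈ toℕ y → x ≡ y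
  ≈⇒≡ᶻ {x} {y} e = FP.toℕ-injective (≈⇒≡ (FP.toℕ<n x) (FP.toℕ<n y) e)

  ≡⇒≈ᶻ : ∀ {x y : ZN s} → x ≡ y → toℕ x ≈ toℕ y
  ≡⇒≈ᶻ refl = ≈-refl

  -- Identities in Z/nZ are reduced to semiring identities in ℕ, with the multiples of n made explicit.
  ≡-by-representatives : ∀ {x y : ZN s} {a b} k l →
    toℕ x ≈ a → toℕ y ≈ b → a + k * n ≡ b + l * n → x ≡ y
  ≡-by-representatives k l x≈a y≈b e =
    ≈⇒≡ᶻ (≈-trans x≈a (≈-trans (≈-by-multiples k l e) (≈-sym y≈b)))

  +-cancelʳ-≈ : ∀ {a b} c → a + c ≈ b + c → a ≈ b
  +-cancelʳ-≈ {a} {b} c e =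
    ≈-trans (≈-by-multiples c 0 (lemma a c s))
      (≈-trans (+-congʳ (2 * s * c) e) (≈-by-multiples 0 c (sym (lemma b c s))))
    where
    lemma : ∀ a c s → a + c * suc (2 * s) ≡ a + c + 2 * s * c + 0 * suc (2 * s)
    lemma = solve-∀

  2*-cancel-≈ : ∀ {a b} → 2 * a ≈ 2 * b → a ≈ b
  2*-cancel-≈ {a} {b} e =
    ≈-trans (≈-by-multiples a 0 (lemma a s))
      (≈-trans (*-congʳ (s + 1) e) (≈-by-multiples 0 b (sym (lemma b s))))
    where
    lemma : ∀ a s → a + a * suc (2 * s) ≡ 2 * a * (s + 1) + 0 * suc (2 * s)
    lemma = solve-∀

  +-≉-self : ∀ {a c} → 0 < c → c < n → ¬ (a + c ≈ a)
  +-≉-self {a} {c} 0<c c<n e = <-irrefl (sym c≡0) 0<c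
    where
    c≡0 : c ≡ 0
    c≡0 = ≈⇒≡ c<n (s≤s z≤n) (+-cancelʳ-≈ a (≈-trans (≈-reflexive (+-comm c a)) e))

  inc dec : ZN s → ZN s
  inc x = addN s x (oneN s)
  dec x = [ toℕ x + 2 * s ]

  mid : ZN s → ZN s → ZN s
  mid = halfSum s

  -- reflect m x = 2m − x, the point whose midpoint with x is m
  reflect : ZN s → ZN s → ZN s
  reflect m x = [ 2 * toℕ m + 2 * s * toℕ x ]

  infixl 6 _⊖_
  _⊖_ : ZN s → ZN s → ZN s
  y ⊖ x = [ toℕ y + 2 * s * toℕ x ]

  neg half : ZN s → ZN s
  neg w = [ 2 * s * toℕ w ]
  half w = [ toℕ w * (s + 1) ]

  toℕ-inc : ∀ x → toℕ (inc x) ≈ toℕ x + 1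
  toℕ-inc x = ≈-trans (toℕ-[] _) (+-congˡ (toℕ x) (toℕ-[] 1))

  toℕ-dec : ∀ x → toℕ (dec x) ≈ toℕ x + 2 * s
  toℕ-dec x = toℕ-[] _

  toℕ-mid : ∀ x y → toℕ (mid x y) ≈ (toℕ x + toℕ y) * (s + 1)
  toℕ-mid x y = toℕ-[] _

  toℕ-reflect : ∀ m x → toℕ (reflect m x) ≈ 2 * toℕ m + 2 * s * toℕ x
  toℕ-reflect m x = toℕ-[] _

  toℕ-⊖ : ∀ y x → toℕ (y ⊖ x) ≈ toℕ y + 2 * s * toℕ x
  toℕ-⊖ y x = toℕ-[] _

  toℕ-neg : ∀ w → toℕ (neg w) ≈ 2 * s * toℕ w
  toℕ-neg w = toℕ-[] _

  toℕ-half : ∀ w → toℕ (half w) ≈ toℕ w * (s + 1)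
  toℕ-half w = toℕ-[] _

  inc-dec : ∀ x → inc (dec x) ≡ x
  inc-dec x = ≡-by-representatives 0 1
      (≈-trans (toℕ-inc (dec x)) (+-congʳ 1 (toℕ-dec x))) ≈-refl (lemma (toℕ x) s)
    where
    lemma : ∀ a s → a + 2 * s + 1 + 0 * suc (2 * s) ≡ a + 1 * suc (2 * s)
    lemma = solve-∀

  dec-inc : ∀ x → dec (inc x) ≡ x
  dec-inc x = ≡-by-representatives 0 1
      (≈-trans (toℕ-dec (inc x)) (+-congʳ (2 * s) (toℕ-inc x))) ≈-refl (lemma (toℕ x) s)
    where
    lemma : ∀ a s → a + 1 + 2 * s + 0 * suc (2 * s) ≡ a + 1 * suc (2 * s)
    lemma = solve-∀

  inc-injective : ∀ {x y} → inc x ≡ inc y → x ≡ y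
  inc-injective {x} {y} e = trans (sym (dec-inc x)) (trans (cong dec e) (dec-inc y))

  dec-injective : ∀ {x y} → dec x ≡ dec y → x ≡ y
  dec-injective {x} {y} e = trans (sym (inc-dec x)) (trans (cong inc e) (inc-dec y))

  dec-≢ : 1 ≤ s → ∀ x → dec x ≢ x
  dec-≢ 1≤s x e = +-≉-self (≤-trans 1≤s (m≤m+n s _)) ≤-refl
    (≈-trans (≈-sym (toℕ-dec x)) (≡⇒≈ᶻ e))

  2*-mid : ∀ x y → 2 * toℕ (mid x y) ≈ toℕ x + toℕ y
  2*-mid x y = ≈-trans (*-congˡ 2 (toℕ-mid x y))
    (≈-by-multiples 0 (toℕ x + toℕ y) (lemma (toℕ x) (toℕ y) s))
    where
    lemma : ∀ a b s → 2 * ((a + b) * (s + 1)) + 0 * suc (2 * s) ≡ a + b + (a + b) * suc (2 * s)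
    lemma = solve-∀

  mid-comm : ∀ x y → mid x y ≡ mid y x
  mid-comm x y = cong (λ z → [ z * (s + 1) ]) (+-comm (toℕ x) (toℕ y))

  mid-reflect : ∀ x m → mid x (reflect m x) ≡ m
  mid-reflect x m = ≈⇒≡ᶻ (2*-cancel-≈ (≈-trans (2*-mid x (reflect m x))
      (≈-trans (+-congˡ (toℕ x) (toℕ-reflect m x))
        (≈-by-multiples 0 (toℕ x) (lemma (toℕ x) (toℕ m) s)))))
    where
    lemma : ∀ a b s → a + (2 * b + 2 * s * a) + 0 * suc (2 * s) ≡ 2 * b + a * suc (2 * s)
    lemma = solve-∀

  reflect-mid : ∀ x y → reflect (mid x y) x ≡ y
  reflect-mid x y = ≈⇒≡ᶻ (≈-trans (toℕ-reflect (mid x y) x)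
      (≈-trans (+-congʳ (2 * s * toℕ x) (2*-mid x y))
        (≈-by-multiples 0 (toℕ x) (lemma (toℕ x) (toℕ y) s))))
    where
    lemma : ∀ a b s → a + b + 2 * s * a + 0 * suc (2 * s) ≡ b + a * suc (2 * s)
    lemma = solve-∀

  reflect-involutive : ∀ m x → reflect m (reflect m x) ≡ x
  reflect-involutive m x = ≈⇒≡ᶻ (≈-trans (toℕ-reflect m (reflect m x))
      (≈-trans (+-congˡ (2 * toℕ m) (*-congˡ (2 * s) (toℕ-reflect m x)))
        (≈-by-multiples (toℕ x) (2 * toℕ m + 2 * s * toℕ x) (lemma (toℕ m) (toℕ x) s))))
    where
    lemma : ∀ a b s → 2 * a + 2 * s * (2 * a + 2 * s * b) + b * suc (2 * s)
                    ≡ b + (2 * a + 2 * s * b) * suc (2 * s)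
    lemma = solve-∀

  ≈-move : ∀ {a b c} → a + 2 * s * b ≈ c → a ≈ c + b
  ≈-move {a} {b} {c} e = ≈-trans (≈-by-multiples b 0 (lemma a b s)) (+-congʳ b e)
    where
    lemma : ∀ a b s → a + b * suc (2 * s) ≡ a + 2 * s * b + b + 0 * suc (2 * s)
    lemma = solve-∀

  mid-≢ˡ : ∀ {x y} → x ≢ y → mid x y ≢ x
  mid-≢ˡ {x} {y} x≢y e = x≢y (sym (≈⇒≡ᶻ (+-cancelʳ-≈ (toℕ x)
    (≈-trans (≈-reflexive (+-comm (toℕ y) (toℕ x)))
      (≈-trans (≈-sym (2*-mid x y))
        (≈-trans (*-congˡ 2 (≡⇒≈ᶻ e)) (≈-reflexive (sym (a+a≡2a (toℕ x))))))))))

  reflect-≢ˡ : ∀ {m x} → m ≢ x → reflect m x ≢ m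
  reflect-≢ˡ {m} {x} m≢x e = m≢x (≈⇒≡ᶻ (+-cancelʳ-≈ (toℕ m)
    (≈-trans (≈-reflexive (a+a≡2a (toℕ m)))
      (≈-trans (≈-move (≈-trans (≈-sym (toℕ-reflect m x)) (≡⇒≈ᶻ e)))
        (≈-reflexive (+-comm (toℕ m) (toℕ x)))))))

  reflect-≢ʳ : ∀ {m x} → x ≢ m → reflect m x ≢ x
  reflect-≢ʳ {m} {x} x≢m e = x≢m (sym (≈⇒≡ᶻ (2*-cancel-≈
    (≈-trans (≈-move (≈-trans (≈-sym (toℕ-reflect m x)) (≡⇒≈ᶻ e)))
      (≈-reflexive (a+a≡2a (toℕ x)))))))

  inc-mid : ∀ x y → mid (inc x) (inc y) ≡ inc (mid x y)
  inc-mid x y = ≡-by-representatives 0 1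
      (≈-trans (toℕ-mid (inc x) (inc y)) (*-congʳ (s + 1) (+-cong (toℕ-inc x) (toℕ-inc y))))
      (≈-trans (toℕ-inc (mid x y)) (+-congʳ 1 (toℕ-mid x y)))
      (lemma (toℕ x) (toℕ y) s)
    where
    lemma : ∀ a b s → (a + 1 + (b + 1)) * (s + 1) + 0 * suc (2 * s)
                    ≡ (a + b) * (s + 1) + 1 + 1 * suc (2 * s)
    lemma = solve-∀

  inc-reflect : ∀ m x → reflect (inc m) (inc x) ≡ inc (reflect m x)
  inc-reflect m x = ≡-by-representatives 0 1
      (≈-trans (toℕ-reflect (inc m) (inc x)) (+-cong (*-congˡ 2 (toℕ-inc m)) (*-congˡ (2 * s) (toℕ-inc x))))
      (≈-trans (toℕ-inc (reflect m x)) (+-congʳ 1 (toℕ-reflect m x)))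
      (lemma (toℕ m) (toℕ x) s)
    where
    lemma : ∀ a b s → 2 * (a + 1) + 2 * s * (b + 1) + 0 * suc (2 * s)
                    ≡ 2 * a + 2 * s * b + 1 + 1 * suc (2 * s)
    lemma = solve-∀

-- The triple systems B(s) and B(s)ᵀ

T-∨⁻ : ∀ x {y} → T (x ∨ y) → T x ⊎ T y
T-∨⁻ x = Equivalence.to (T-∨ {x})

T-∨⁺ˡ : ∀ x {y} → T x → T (x ∨ y)
T-∨⁺ˡ x = Equivalence.from (T-∨ {x}) ∘ inj₁

T-∨⁺ʳ : ∀ x {y} → T y → T (x ∨ y)
T-∨⁺ʳ x = Equivalence.from (T-∨ {x}) ∘ inj₂

T-∧⁻ : ∀ x {y} → T (x ∧ y) → T x × T y
T-∧⁻ x = Equivalence.to (T-∧ {x})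

T-∧⁺ : ∀ {x y} → T x → T y → T (x ∧ y)
T-∧⁺ {x} tx ty = Equivalence.from (T-∧ {x}) (tx , ty)

T⇒≡true : ∀ {b} → T b → b ≡ true
T⇒≡true {b} = Equivalence.to (T-≡ {b})

≡true⇒T : ∀ {b} → b ≡ true → T b
≡true⇒T {b} = Equivalence.from (T-≡ {b})

T-not⇒≡false : ∀ {b} → T (not b) → b ≡ false
T-not⇒≡false {b} = Equivalence.to (T-not-≡ {b})

≡false⇒T-not : ∀ {b} → b ≡ false → T (not b)
≡false⇒T-not {b} = Equivalence.from (T-not-≡ {b})

T-not-not⁺ : ∀ {b} → T b → T (not (not b))
T-not-not⁺ {true} _ = _

T-not-not⁻ : ∀ {b} → T (not (not b)) → b ≡ true
T-not-not⁻ {true} _ = refl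

T-contradiction : ∀ {b} → T b → T (not b) → ⊥
T-contradiction {true} _ ()

any-witness : ∀ {A : Set} (p : A → Bool) xs → T (any p xs) → ∃ λ x → T (p x)
any-witness p xs = satisfied ∘ any⁻ p xs

any-intro : ∀ {A : Set} (p : A → Bool) {xs x} → x ∈ xs → T (p x) → T (any p xs)
any-intro p x∈xs px = any⁺ p (lose x∈xs px)

data Perm3 {A : Set} (a b c : A) : A → A → A → Set where
  p123 : Perm3 a b c a b c
  p132 : Perm3 a b c a c b
  p213 : Perm3 a b c b a c
  p231 : Perm3 a b c b c a
  p312 : Perm3 a b c c a b
  p321 : Perm3 a b c c b a

Perm3-map : ∀ {A B : Set} (f : A → B) {a b c p q r} →
  Perm3 a b c p q r → Perm3 (f a) (f b) (f c) (f p) (f q) (f r)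
Perm3-map f p123 = p123
Perm3-map f p132 = p132
Perm3-map f p213 = p213
Perm3-map f p231 = p231
Perm3-map f p312 = p312
Perm3-map f p321 = p321

module _ {k : ℕ} where

  private
    P : Set
    P = Fin k × Fin 3

  =V-sound : ∀ {a b : P} → T (a =V b) → a ≡ b
  =V-sound = toWitness

  =V-complete : ∀ {a b : P} → a ≡ b → T (a =V b)
  =V-complete = fromWitness

  =V-refl : ∀ (a : P) → T (a =V a)
  =V-refl a = =V-complete {a} refl

  private
    ≡³ : ∀ {a b c u v w : P} → T (a =V u ∧ b =V v ∧ c =V w) → (a , b , c) ≡ (u , v , w)
    ≡³ {a} {b} t with T-∧⁻ (a =V _) t
    ... | au , t′ with T-∧⁻ (b =V _) t′
    ... | bv , cw with =V-sound au | =V-sound bv | =V-sound cw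
    ... | refl | refl | refl = refl

    ≡³⁺ : ∀ (a b c : P) → T (a =V a ∧ b =V b ∧ c =V c)
    ≡³⁺ a b c = T-∧⁺ {a =V a} (=V-refl a) (T-∧⁺ {b =V b} (=V-refl b) (=V-refl c))

    perm : ∀ {a b c p q r u v w : P} → T (a =V u ∧ b =V v ∧ c =V w) →
      Perm3 p q r u v w → Perm3 p q r a b c
    perm {a} {b} {c} {p} {q} {r} {u} {v} {w} t π with ≡³ {a} {b} {c} {u} {v} {w} t
    ... | refl = π

  samePerm⇒Perm3 : ∀ {a b c p q r : P} → T (samePerm a b c p q r) → Perm3 p q r a b c
  samePerm⇒Perm3 {a} {b} {c} {p} {q} {r} t with T-∨⁻ (a =V p ∧ b =V q ∧ c =V r) t
  ... | inj₁ t₁ = perm t₁ p123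
  ... | inj₂ t₁ with T-∨⁻ (a =V p ∧ b =V r ∧ c =V q) t₁
  ... | inj₁ t₂ = perm t₂ p132
  ... | inj₂ t₂ with T-∨⁻ (a =V q ∧ b =V p ∧ c =V r) t₂
  ... | inj₁ t₃ = perm t₃ p213
  ... | inj₂ t₃ with T-∨⁻ (a =V q ∧ b =V r ∧ c =V p) t₃
  ... | inj₁ t₄ = perm t₄ p231
  ... | inj₂ t₄ with T-∨⁻ (a =V r ∧ b =V p ∧ c =V q) t₄
  ... | inj₁ t₅ = perm t₅ p312
  ... | inj₂ t₆ = perm t₆ p321

  Perm3⇒samePerm : ∀ {p q r a b c : P} → Perm3 p q r a b c → T (samePerm a b c p q r)
  Perm3⇒samePerm {p} {q} {r} p123 = T-∨⁺ˡ _ (≡³⁺ p q r)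
  Perm3⇒samePerm {p} {q} {r} p132 = T-∨⁺ʳ (p =V p ∧ _) (T-∨⁺ˡ _ (≡³⁺ p r q))
  Perm3⇒samePerm {p} {q} {r} p213 =
    T-∨⁺ʳ (q =V p ∧ _) (T-∨⁺ʳ (q =V p ∧ _) (T-∨⁺ˡ _ (≡³⁺ q p r)))
  Perm3⇒samePerm {p} {q} {r} p231 =
    T-∨⁺ʳ (q =V p ∧ _) (T-∨⁺ʳ (q =V p ∧ _) (T-∨⁺ʳ (q =V q ∧ _) (T-∨⁺ˡ _ (≡³⁺ q r p))))
  Perm3⇒samePerm {p} {q} {r} p312 =
    T-∨⁺ʳ (r =V p ∧ _) (T-∨⁺ʳ (r =V p ∧ _) (T-∨⁺ʳ (r =V q ∧ _) (T-∨⁺ʳ (r =V q ∧ _)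
      (T-∨⁺ˡ _ (≡³⁺ r p q)))))
  Perm3⇒samePerm {p} {q} {r} p321 =
    T-∨⁺ʳ (r =V p ∧ _) (T-∨⁺ʳ (r =V p ∧ _) (T-∨⁺ʳ (r =V q ∧ _) (T-∨⁺ʳ (r =V q ∧ _)
      (T-∨⁺ʳ (r =V r ∧ _) (≡³⁺ r q p)))))

pattern l0 = f0
pattern l1 = fs f0
pattern l2 = fs (fs f0)

-- junk value l0 on equal levels
otherLevel : Fin 3 → Fin 3 → Fin 3
otherLevel l0 l1 = l2
otherLevel l0 l2 = l1
otherLevel l1 l0 = l2
otherLevel l1 l2 = l0
otherLevel l2 l0 = l1
otherLevel l2 l1 = l0
otherLevel _  _  = l0

otherLevel-comm : ∀ y₁ y₂ → otherLevel y₁ y₂ ≡ otherLevel y₂ y₁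
otherLevel-comm l0 l0 = refl
otherLevel-comm l0 l1 = refl
otherLevel-comm l0 l2 = refl
otherLevel-comm l1 l0 = refl
otherLevel-comm l1 l1 = refl
otherLevel-comm l1 l2 = refl
otherLevel-comm l2 l0 = refl
otherLevel-comm l2 l1 = refl
otherLevel-comm l2 l2 = refl

module Bose (s : ℕ) where

  open Zmod s public

  ∈-allV : ∀ (v : V s) → v ∈ allV s
  ∈-allV (x , y) = ∈-cartesianProduct⁺ (∈-allFin x) (∈-allFin y)

  -- For x₁ ≢ x₂: on a common level the third point is the midpoint, one level up; on consecutive
  -- levels it is the lower point reflected in the upper one.
  thirdHor : ZN s → Fin 3 → ZN s → Fin 3 → V s
  thirdHor x₁ l0 x₂ l0 = (mid x₁ x₂ , l1)
  thirdHor x₁ l1 x₂ l1 = (mid x₁ x₂ , l2)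
  thirdHor x₁ l2 x₂ l2 = (mid x₁ x₂ , l0)
  thirdHor x₁ l0 x₂ l1 = (reflect x₂ x₁ , l0)
  thirdHor x₁ l1 x₂ l2 = (reflect x₂ x₁ , l1)
  thirdHor x₁ l2 x₂ l0 = (reflect x₂ x₁ , l2)
  thirdHor x₁ l1 x₂ l0 = (reflect x₁ x₂ , l0)
  thirdHor x₁ l2 x₂ l1 = (reflect x₁ x₂ , l1)
  thirdHor x₁ l0 x₂ l2 = (reflect x₁ x₂ , l2)

  thirdHor-comm : ∀ x₁ y₁ x₂ y₂ → thirdHor x₁ y₁ x₂ y₂ ≡ thirdHor x₂ y₂ x₁ y₁
  thirdHor-comm x₁ l0 x₂ l0 = cong (_, l1) (mid-comm x₁ x₂)
  thirdHor-comm x₁ l1 x₂ l1 = cong (_, l2) (mid-comm x₁ x₂)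
  thirdHor-comm x₁ l2 x₂ l2 = cong (_, l0) (mid-comm x₁ x₂)
  thirdHor-comm x₁ l0 x₂ l1 = refl
  thirdHor-comm x₁ l1 x₂ l2 = refl
  thirdHor-comm x₁ l2 x₂ l0 = refl
  thirdHor-comm x₁ l1 x₂ l0 = refl
  thirdHor-comm x₁ l2 x₂ l1 = refl
  thirdHor-comm x₁ l0 x₂ l2 = refl

  thirdDec : (x₁ : ZN s) → Fin 3 → (x₂ : ZN s) → Fin 3 → Dec (x₁ ≡ x₂) → V s
  thirdDec x₁ y₁ x₂ y₂ (yes _) = (x₁ , otherLevel y₁ y₂)
  thirdDec x₁ y₁ x₂ y₂ (no _)  = thirdHor x₁ y₁ x₂ y₂

  third : V s → V s → V s
  third (x₁ , y₁) (x₂ , y₂) = thirdDec x₁ y₁ x₂ y₂ (x₁ FP.≟ x₂)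

  third-ver : ∀ x y₁ y₂ → third (x , y₁) (x , y₂) ≡ (x , otherLevel y₁ y₂)
  third-ver x y₁ y₂ with x FP.≟ x
  ... | yes _ = refl
  ... | no x≢x = ⊥-elim (x≢x refl)

  third-hor : ∀ {x₁ x₂} y₁ y₂ → x₁ ≢ x₂ → third (x₁ , y₁) (x₂ , y₂) ≡ thirdHor x₁ y₁ x₂ y₂
  third-hor {x₁} {x₂} y₁ y₂ x₁≢x₂ with x₁ FP.≟ x₂
  ... | yes x₁≡x₂ = ⊥-elim (x₁≢x₂ x₁≡x₂)
  ... | no _ = refl

  third-comm : ∀ a b → third a b ≡ third b a
  third-comm (x₁ , y₁) (x₂ , y₂) with x₁ FP.≟ x₂ | x₂ FP.≟ x₁
  ... | yes refl | yes _ = cong (x₁ ,_) (otherLevel-comm y₁ y₂)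
  ... | yes e | no ne = ⊥-elim (ne (sym e))
  ... | no ne | yes e = ⊥-elim (ne (sym e))
  ... | no _ | no _ = thirdHor-comm x₁ y₁ x₂ y₂

  InB : V s → V s → V s → Set
  InB a b c = a ≢ b × c ≡ third a b

  ≢-level : ∀ {x₁ x₂ : ZN s} {y₁ y₂ : Fin 3} → y₁ ≢ y₂ → (x₁ , y₁) ≢ (x₂ , y₂)
  ≢-level ne = ne ∘ cong proj₂

  ≢-position : ∀ {x₁ x₂ : ZN s} {y₁ y₂ : Fin 3} → x₁ ≢ x₂ → (x₁ , y₁) ≢ (x₂ , y₂)
  ≢-position ne = ne ∘ cong proj₁

  InB-swap₁₂ : ∀ {a b c} → InB a b c → InB b a c
  InB-swap₁₂ {a} {b} (a≢b , c≡) = a≢b ∘ sym , trans c≡ (third-comm a b)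

  InB-ver : ∀ x y₁ y₂ → y₁ ≢ y₂ → InB (x , y₁) (x , otherLevel y₁ y₂) (x , y₂)
  InB-ver x l0 l0 ne = ⊥-elim (ne refl)
  InB-ver x l1 l1 ne = ⊥-elim (ne refl)
  InB-ver x l2 l2 ne = ⊥-elim (ne refl)
  InB-ver x l0 l1 ne = ≢-level (λ ()) , sym (third-ver x l0 l2)
  InB-ver x l0 l2 ne = ≢-level (λ ()) , sym (third-ver x l0 l1)
  InB-ver x l1 l0 ne = ≢-level (λ ()) , sym (third-ver x l1 l2)
  InB-ver x l1 l2 ne = ≢-level (λ ()) , sym (third-ver x l1 l0)
  InB-ver x l2 l0 ne = ≢-level (λ ()) , sym (third-ver x l2 l1)
  InB-ver x l2 l1 ne = ≢-level (λ ()) , sym (third-ver x l2 l0)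

  InB-by-thirdHor : ∀ {x₁ z c} y₁ y₃ → x₁ ≢ z → thirdHor x₁ y₁ z y₃ ≡ c → InB (x₁ , y₁) (z , y₃) c
  InB-by-thirdHor y₁ y₃ x₁≢z e = ≢-position x₁≢z , sym (trans (third-hor y₁ y₃ x₁≢z) e)

  InB-hor : ∀ {x₁ x₂} y₁ y₂ → x₁ ≢ x₂ → InB (x₁ , y₁) (thirdHor x₁ y₁ x₂ y₂) (x₂ , y₂)
  InB-hor {x₁} {x₂} l0 l0 ne = InB-by-thirdHor l0 l1 (mid-≢ˡ ne ∘ sym) (cong (_, l0) (reflect-mid x₁ x₂))
  InB-hor {x₁} {x₂} l1 l1 ne = InB-by-thirdHor l1 l2 (mid-≢ˡ ne ∘ sym) (cong (_, l1) (reflect-mid x₁ x₂))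
  InB-hor {x₁} {x₂} l2 l2 ne = InB-by-thirdHor l2 l0 (mid-≢ˡ ne ∘ sym) (cong (_, l2) (reflect-mid x₁ x₂))
  InB-hor {x₁} {x₂} l0 l1 ne = InB-by-thirdHor l0 l0 (reflect-≢ʳ ne ∘ sym) (cong (_, l1) (mid-reflect x₁ x₂))
  InB-hor {x₁} {x₂} l1 l2 ne = InB-by-thirdHor l1 l1 (reflect-≢ʳ ne ∘ sym) (cong (_, l2) (mid-reflect x₁ x₂))
  InB-hor {x₁} {x₂} l2 l0 ne = InB-by-thirdHor l2 l2 (reflect-≢ʳ ne ∘ sym) (cong (_, l0) (mid-reflect x₁ x₂))
  InB-hor {x₁} {x₂} l1 l0 ne = InB-by-thirdHor l1 l0 (reflect-≢ˡ ne ∘ sym) (cong (_, l0) (reflect-involutive x₁ x₂))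
  InB-hor {x₁} {x₂} l2 l1 ne = InB-by-thirdHor l2 l1 (reflect-≢ˡ ne ∘ sym) (cong (_, l1) (reflect-involutive x₁ x₂))
  InB-hor {x₁} {x₂} l0 l2 ne = InB-by-thirdHor l0 l2 (reflect-≢ˡ ne ∘ sym) (cong (_, l2) (reflect-involutive x₁ x₂))

  InB-swap₂₃ : ∀ {a b c} → InB a b c → InB a c b
  InB-swap₂₃ {x₁ , y₁} {x₂ , y₂} (a≢b , refl) with x₁ FP.≟ x₂
  ... | yes refl = InB-ver x₁ y₁ y₂ (a≢b ∘ cong (x₁ ,_))
  ... | no x₁≢x₂ = InB-hor y₁ y₂ x₁≢x₂

  InB-perm : ∀ {a b c p q r} → InB a b c → Perm3 a b c p q r → InB p q r
  InB-perm i p123 = i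
  InB-perm i p132 = InB-swap₂₃ i
  InB-perm i p213 = InB-swap₁₂ i
  InB-perm i p231 = InB-swap₂₃ (InB-swap₁₂ i)
  InB-perm i p312 = InB-swap₁₂ (InB-swap₂₃ i)
  InB-perm i p321 = InB-swap₂₃ (InB-swap₁₂ (InB-swap₂₃ i))

  private
    verGen : V s → V s → V s → ZN s → Bool
    verGen a b c x = samePerm a b c (x , f0) (x , one3) (x , two3)

    horGen : V s → V s → V s → ZN s → ZN s → Fin 3 → Bool
    horGen a b c x₁ x₂ y =
      not ⌊ x₁ FP.≟ x₂ ⌋ ∧ samePerm a b c (x₁ , y) (x₂ , y) (halfSum s x₁ x₂ , add3 y one3)

    InB-horGen : ∀ {x₁ x₂} y → x₁ ≢ x₂ → InB (x₁ , y) (x₂ , y) (mid x₁ x₂ , add3 y one3)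
    InB-horGen l0 ne = ≢-position ne , sym (third-hor l0 l0 ne)
    InB-horGen l1 ne = ≢-position ne , sym (third-hor l1 l1 ne)
    InB-horGen l2 ne = ≢-position ne , sym (third-hor l2 l2 ne)

  inB⇒InB : ∀ a b c → T (inB s a b c) → InB a b c
  inB⇒InB a b c t = [ fromVer , fromHor ]′ (T-∨⁻ (any (verGen a b c) (allFin n)) t)
    where
    fromVer : T (any (verGen a b c) (allFin n)) → InB a b c
    fromVer t-ver with any-witness (verGen a b c) (allFin n) t-ver
    ... | x , π = InB-perm (InB-ver x l0 l2 (λ ())) (samePerm⇒Perm3 π)

    fromHor₃ : ∀ x₁ x₂ → T (any (horGen a b c x₁ x₂) (allFin 3)) → InB a b c
    fromHor₃ x₁ x₂ t₃ with any-witness (horGen a b c x₁ x₂) (allFin 3) t₃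
    ... | y , t₄ with T-∧⁻ (not ⌊ x₁ FP.≟ x₂ ⌋) t₄
    ... | ne , π = InB-perm (InB-horGen y (toWitnessFalse ne)) (samePerm⇒Perm3 π)

    fromHor : T (any (λ x₁ → any (λ x₂ → any (horGen a b c x₁ x₂) (allFin 3)) (allFin n)) (allFin n)) →
      InB a b c
    fromHor t-hor with any-witness _ (allFin n) t-hor
    ... | x₁ , t₁ with any-witness _ (allFin n) t₁
    ... | x₂ , t₂ = fromHor₃ x₁ x₂ t₂

  private
    verGen⇒inB : ∀ {a b c} x → Perm3 (x , l0) (x , l1) (x , l2) a b c → T (inB s a b c)
    verGen⇒inB {a} {b} {c} x π =
      T-∨⁺ˡ (any (verGen a b c) (allFin n)) (any-intro (verGen a b c) (∈-allFin x) (Perm3⇒samePerm π))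

    horGen⇒inB : ∀ {a b c x₁ x₂ m} y → x₁ ≢ x₂ → mid x₁ x₂ ≡ m →
      Perm3 (x₁ , y) (x₂ , y) (m , add3 y one3) a b c → T (inB s a b c)
    horGen⇒inB {a} {b} {c} {x₁} {x₂} y ne refl π =
      T-∨⁺ʳ (any (verGen a b c) (allFin n))
        (any-intro _ (∈-allFin x₁) (any-intro _ (∈-allFin x₂)
          (any-intro (horGen a b c x₁ x₂) (∈-allFin y) (T-∧⁺ {not ⌊ x₁ FP.≟ x₂ ⌋} (fromWitnessFalse ne) (Perm3⇒samePerm π)))))

    ver⇒inB : ∀ x y₁ y₂ → y₁ ≢ y₂ → T (inB s (x , y₁) (x , y₂) (x , otherLevel y₁ y₂))
    ver⇒inB x l0 l0 ne = ⊥-elim (ne refl)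
    ver⇒inB x l1 l1 ne = ⊥-elim (ne refl)
    ver⇒inB x l2 l2 ne = ⊥-elim (ne refl)
    ver⇒inB x l0 l1 ne = verGen⇒inB x p123
    ver⇒inB x l0 l2 ne = verGen⇒inB x p132
    ver⇒inB x l1 l0 ne = verGen⇒inB x p213
    ver⇒inB x l1 l2 ne = verGen⇒inB x p231
    ver⇒inB x l2 l0 ne = verGen⇒inB x p312
    ver⇒inB x l2 l1 ne = verGen⇒inB x p321

    hor⇒inB : ∀ x₁ x₂ y₁ y₂ → x₁ ≢ x₂ → T (inB s (x₁ , y₁) (x₂ , y₂) (thirdHor x₁ y₁ x₂ y₂))
    hor⇒inB x₁ x₂ l0 l0 ne = horGen⇒inB l0 ne refl p123
    hor⇒inB x₁ x₂ l1 l1 ne = horGen⇒inB l1 ne refl p123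
    hor⇒inB x₁ x₂ l2 l2 ne = horGen⇒inB l2 ne refl p123
    hor⇒inB x₁ x₂ l0 l1 ne = horGen⇒inB l0 (reflect-≢ʳ ne ∘ sym) (mid-reflect x₁ x₂) p132
    hor⇒inB x₁ x₂ l1 l2 ne = horGen⇒inB l1 (reflect-≢ʳ ne ∘ sym) (mid-reflect x₁ x₂) p132
    hor⇒inB x₁ x₂ l2 l0 ne = horGen⇒inB l2 (reflect-≢ʳ ne ∘ sym) (mid-reflect x₁ x₂) p132
    hor⇒inB x₁ x₂ l1 l0 ne = horGen⇒inB l0 (reflect-≢ʳ (ne ∘ sym) ∘ sym) (mid-reflect x₂ x₁) p312
    hor⇒inB x₁ x₂ l2 l1 ne = horGen⇒inB l1 (reflect-≢ʳ (ne ∘ sym) ∘ sym) (mid-reflect x₂ x₁) p312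
    hor⇒inB x₁ x₂ l0 l2 ne = horGen⇒inB l2 (reflect-≢ʳ (ne ∘ sym) ∘ sym) (mid-reflect x₂ x₁) p312

  InB⇒inB : ∀ a b c → InB a b c → T (inB s a b c)
  InB⇒inB (x₁ , y₁) (x₂ , y₂) c (a≢b , refl) with x₁ FP.≟ x₂
  ... | yes refl = ver⇒inB x₁ y₁ y₂ (a≢b ∘ cong (x₁ ,_))
  ... | no x₁≢x₂ = hor⇒inB x₁ x₂ y₁ y₂ x₁≢x₂

module Complex (s : ℕ) where

  open Bose s public

  τ : V s → V s
  τ = Tperm s

  τ⁻¹ : V s → V s
  τ⁻¹ (x , l0) = (x , l0)
  τ⁻¹ (x , l1) = (dec x , l2)
  τ⁻¹ (x , l2) = (dec x , l1)

  τ-τ⁻¹ : ∀ v → τ (τ⁻¹ v) ≡ v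
  τ-τ⁻¹ (x , l0) = refl
  τ-τ⁻¹ (x , l1) = cong (_, l1) (inc-dec x)
  τ-τ⁻¹ (x , l2) = cong (_, l2) (inc-dec x)

  τ⁻¹-τ : ∀ v → τ⁻¹ (τ v) ≡ v
  τ⁻¹-τ (x , l0) = refl
  τ⁻¹-τ (x , l1) = cong (_, l1) (dec-inc x)
  τ⁻¹-τ (x , l2) = cong (_, l2) (dec-inc x)

  τ⁻¹-injective : ∀ {a b} → τ⁻¹ a ≡ τ⁻¹ b → a ≡ b
  τ⁻¹-injective {a} {b} e = trans (sym (τ-τ⁻¹ a)) (trans (cong τ e) (τ-τ⁻¹ b))

  thirdᵀ : V s → V s → V s
  thirdᵀ a b = τ (third (τ⁻¹ a) (τ⁻¹ b))

  thirdᵀ-comm : ∀ a b → thirdᵀ a b ≡ thirdᵀ b a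
  thirdᵀ-comm a b = cong τ (third-comm (τ⁻¹ a) (τ⁻¹ b))

  InBᵀ : V s → V s → V s → Set
  InBᵀ a b c = a ≢ b × c ≡ thirdᵀ a b

  InB-τ⁻¹⇒InBᵀ : ∀ {a b c} → InB (τ⁻¹ a) (τ⁻¹ b) (τ⁻¹ c) → InBᵀ a b c
  InB-τ⁻¹⇒InBᵀ {c = c} (a≢b , c≡) = a≢b ∘ cong τ⁻¹ , trans (sym (τ-τ⁻¹ c)) (cong τ c≡)

  InBᵀ⇒InB-τ⁻¹ : ∀ {a b c} → InBᵀ a b c → InB (τ⁻¹ a) (τ⁻¹ b) (τ⁻¹ c)
  InBᵀ⇒InB-τ⁻¹ (a≢b , c≡) = a≢b ∘ τ⁻¹-injective , trans (cong τ⁻¹ c≡) (τ⁻¹-τ _)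

  InBᵀ-perm : ∀ {a b c p q r} → InBᵀ a b c → Perm3 a b c p q r → InBᵀ p q r
  InBᵀ-perm i π = InB-τ⁻¹⇒InBᵀ (InB-perm (InBᵀ⇒InB-τ⁻¹ i) (Perm3-map τ⁻¹ π))

  private
    genᵀ : V s → V s → V s → V s → V s → V s → Bool
    genᵀ a b c p q r = inB s p q r ∧ samePerm a b c (τ p) (τ q) (τ r)

    genᵀ₂ : V s → V s → V s → V s → V s → Bool
    genᵀ₂ a b c p q = any (genᵀ a b c p q) (allV s)

    genᵀ₁ : V s → V s → V s → V s → Bool
    genᵀ₁ a b c p = any (genᵀ₂ a b c p) (allV s)

  InB⇒InBᵀ-τ : ∀ {p q r a b c} → InB p q r → Perm3 (τ p) (τ q) (τ r) a b c → InBᵀ a b c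
  InB⇒InBᵀ-τ {p} {q} {r} i π with Perm3-map τ⁻¹ π
  ... | π⁻¹ rewrite τ⁻¹-τ p | τ⁻¹-τ q | τ⁻¹-τ r = InB-τ⁻¹⇒InBᵀ (InB-perm i π⁻¹)

  inBT⇒InBᵀ : ∀ a b c → T (inBT s a b c) → InBᵀ a b c
  inBT⇒InBᵀ a b c t =
    let p , t₁ = any-witness (genᵀ₁ a b c) (allV s) t
        q , t₂ = any-witness (genᵀ₂ a b c p) (allV s) t₁
        r , t₃ = any-witness (genᵀ a b c p q) (allV s) t₂
        pqr , π = T-∧⁻ (inB s p q r) t₃
    in InB⇒InBᵀ-τ (inB⇒InB p q r pqr) (samePerm⇒Perm3 π)

  private
    samePerm-τ-τ⁻¹ : ∀ a b c → T (samePerm a b c (τ (τ⁻¹ a)) (τ (τ⁻¹ b)) (τ (τ⁻¹ c)))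
    samePerm-τ-τ⁻¹ a b c rewrite τ-τ⁻¹ a | τ-τ⁻¹ b | τ-τ⁻¹ c = Perm3⇒samePerm {p = a} {q = b} {r = c} p123

  InBᵀ⇒inBT : ∀ a b c → InBᵀ a b c → T (inBT s a b c)
  InBᵀ⇒inBT a b c i =
    any-intro (genᵀ₁ a b c) (∈-allV (τ⁻¹ a)) (any-intro (genᵀ₂ a b c (τ⁻¹ a)) (∈-allV (τ⁻¹ b))
      (any-intro (genᵀ a b c (τ⁻¹ a) (τ⁻¹ b)) (∈-allV (τ⁻¹ c))
        (T-∧⁺ {inB s (τ⁻¹ a) (τ⁻¹ b) (τ⁻¹ c)} (InB⇒inB _ _ _ (InBᵀ⇒InB-τ⁻¹ i)) (samePerm-τ-τ⁻¹ a b c))))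

  Face′ : V s → V s → V s → Set
  Face′ a b c = a ≢ b × (c ≡ third a b ⊎ c ≡ thirdᵀ a b)

  Face⇒Face′ : ∀ {a b c} → Face s a b c → Face′ a b c
  Face⇒Face′ {a} {b} {c} f = [ fromB , fromBᵀ ]′ (T-∨⁻ (inB s a b c) {inBT s a b c} f)
    where
    fromB : T (inB s a b c) → Face′ a b c
    fromB t = proj₁ (inB⇒InB a b c t) , inj₁ (proj₂ (inB⇒InB a b c t))
    fromBᵀ : T (inBT s a b c) → Face′ a b c
    fromBᵀ t = proj₁ (inBT⇒InBᵀ a b c t) , inj₂ (proj₂ (inBT⇒InBᵀ a b c t))

  InB⇒Face : ∀ {a b c} → InB a b c → Face s a b c
  InB⇒Face {a} {b} {c} i = T-∨⁺ˡ (inB s a b c) {inBT s a b c} (InB⇒inB a b c i)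

  InBᵀ⇒Face : ∀ {a b c} → InBᵀ a b c → Face s a b c
  InBᵀ⇒Face {a} {b} {c} i = T-∨⁺ʳ (inB s a b c) {inBT s a b c} (InBᵀ⇒inBT a b c i)

  Face′⇒Face : ∀ {a b c} → Face′ a b c → Face s a b c
  Face′⇒Face (a≢b , inj₁ e) = InB⇒Face (a≢b , e)
  Face′⇒Face (a≢b , inj₂ e) = InBᵀ⇒Face (a≢b , e)

  private
    third≢thirdᵀ-≤ : 1 ≤ s → ∀ x₁ y₁ x₂ y₂ → toℕ y₁ ≤ toℕ y₂ → (x₁ , y₁) ≢ (x₂ , y₂) →
      third (x₁ , y₁) (x₂ , y₂) ≢ thirdᵀ (x₁ , y₁) (x₂ , y₂)
    third≢thirdᵀ-≤ _ x₁ l0 x₂ l0 _ ne with x₁ FP.≟ x₂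
    ... | yes refl = ⊥-elim (ne refl)
    ... | no _ = ≢-level (λ ())
    third≢thirdᵀ-≤ _ x₁ l1 x₂ l1 _ ne with x₁ FP.≟ x₂ | dec x₁ FP.≟ dec x₂
    ... | yes refl | _ = ⊥-elim (ne refl)
    ... | no x₁≢x₂ | yes e = ⊥-elim (x₁≢x₂ (dec-injective e))
    ... | no _ | no _ = ≢-level (λ ())
    third≢thirdᵀ-≤ _ x₁ l2 x₂ l2 _ ne with x₁ FP.≟ x₂ | dec x₁ FP.≟ dec x₂
    ... | yes refl | _ = ⊥-elim (ne refl)
    ... | no x₁≢x₂ | yes e = ⊥-elim (x₁≢x₂ (dec-injective e))
    ... | no _ | no _ = ≢-level (λ ())
    third≢thirdᵀ-≤ 1≤s x₁ l0 x₂ l1 _ ne with x₁ FP.≟ x₂ | x₁ FP.≟ dec x₂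
    ... | yes refl | yes e = ⊥-elim (dec-≢ 1≤s x₁ (sym e))
    ... | yes refl | no _ = ≢-level (λ ())
    ... | no _ | yes _ = ≢-level (λ ())
    ... | no _ | no _ = ≢-level (λ ())
    third≢thirdᵀ-≤ 1≤s x₁ l0 x₂ l2 _ ne with x₁ FP.≟ x₂ | x₁ FP.≟ dec x₂
    ... | yes refl | yes e = ⊥-elim (dec-≢ 1≤s x₁ (sym e))
    ... | yes refl | no _ = ≢-level (λ ())
    ... | no _ | yes _ = ≢-level (λ ())
    ... | no _ | no _ = ≢-level (λ ())
    third≢thirdᵀ-≤ 1≤s x₁ l1 x₂ l2 _ ne with x₁ FP.≟ x₂ | dec x₁ FP.≟ dec x₂
    ... | yes refl | yes _ = λ e → dec-≢ 1≤s x₁ (sym (cong proj₁ e))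
    ... | yes refl | no dx≢dx = ⊥-elim (dx≢dx refl)
    ... | no x₁≢x₂ | yes e = ⊥-elim (x₁≢x₂ (dec-injective e))
    ... | no _ | no _ = ≢-level (λ ())
    third≢thirdᵀ-≤ _ x₁ l1 x₂ l0 () ne
    third≢thirdᵀ-≤ _ x₁ l2 x₂ l0 () ne
    third≢thirdᵀ-≤ _ x₁ l2 x₂ l1 (s≤s ()) ne

  third≢thirdᵀ : 1 ≤ s → ∀ a b → a ≢ b → third a b ≢ thirdᵀ a b
  third≢thirdᵀ 1≤s (x₁ , y₁) (x₂ , y₂) ne with toℕ y₁ ≤? toℕ y₂
  ... | yes y₁≤y₂ = third≢thirdᵀ-≤ 1≤s x₁ y₁ x₂ y₂ y₁≤y₂ ne
  ... | no y₁≰y₂ = λ e → third≢thirdᵀ-≤ 1≤s x₂ y₂ x₁ y₁ (<⇒≤ (≰⇒> y₁≰y₂)) (ne ∘ sym)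
      (trans (sym (third-comm (x₁ , y₁) (x₂ , y₂))) (trans e (thirdᵀ-comm (x₁ , y₁) (x₂ , y₂))))

-- Sums over enumerated finite types

𝟙 : Bool → ℕ
𝟙 true  = 1
𝟙 false = 0

𝟙-not : ∀ b → 𝟙 (not b) + 𝟙 b ≡ 1
𝟙-not true  = refl
𝟙-not false = refl

𝟙-∧ : ∀ u v → 𝟙 (u ∧ v) ≡ 𝟙 u * 𝟙 v
𝟙-∧ true  v = sym (+-identityʳ (𝟙 v))
𝟙-∧ false v = refl

𝟙-∧-implied : ∀ x y → (T x → T y) → 𝟙 (x ∧ y) ≡ 𝟙 x
𝟙-∧-implied true  true  _   = refl
𝟙-∧-implied true  false x⇒y = ⊥-elim (x⇒y _)
𝟙-∧-implied false _     _   = refl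

𝟙-false : ∀ f → ¬ T f → 𝟙 f ≡ 0
𝟙-false true  ¬f = ⊥-elim (¬f _)
𝟙-false false _  = refl

𝟙-exclusive-∨ : ∀ f u w → (T f ⇔ (T u ⊎ T w)) → (T u → T w → ⊥) → 𝟙 f ≡ 𝟙 u + 𝟙 w
𝟙-exclusive-∨ true  true  true  _ excl = ⊥-elim (excl _ _)
𝟙-exclusive-∨ true  true  false _ _    = refl
𝟙-exclusive-∨ true  false true  _ _    = refl
𝟙-exclusive-∨ true  false false f⇔ _   with Equivalence.to f⇔ _
... | inj₁ ()
... | inj₂ ()
𝟙-exclusive-∨ false true  _     f⇔ _   = ⊥-elim (Equivalence.from f⇔ (inj₁ _))
𝟙-exclusive-∨ false false true  f⇔ _   = ⊥-elim (Equivalence.from f⇔ (inj₂ _))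
𝟙-exclusive-∨ false false false _ _    = refl

∑ : ∀ {A : Set} → List A → (A → ℕ) → ℕ
∑ []       f = 0
∑ (x ∷ xs) f = f x + ∑ xs f

syntax ∑ xs (λ x → e) = ∑[ x ∈ xs ] e

private
  variable
    A B : Set

∑-cong : ∀ {f g : A → ℕ} xs → (∀ x → f x ≡ g x) → ∑ xs f ≡ ∑ xs g
∑-cong []       f≗g = refl
∑-cong (x ∷ xs) f≗g = cong₂ _+_ (f≗g x) (∑-cong xs f≗g)

∑-+ : ∀ (f g : A → ℕ) xs → ∑[ x ∈ xs ] (f x + g x) ≡ ∑ xs f + ∑ xs g
∑-+ f g []       = refl
∑-+ f g (x ∷ xs) = begin
  f x + g x + ∑[ x ∈ xs ] (f x + g x)  ≡⟨ cong (f x + g x +_) (∑-+ f g xs) ⟩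
  f x + g x + (∑ xs f + ∑ xs g)         ≡⟨ +-assoc (f x) (g x) _ ⟩
  f x + (g x + (∑ xs f + ∑ xs g))       ≡⟨ cong (f x +_) (x+[y+z]≡y+[x+z] (g x) (∑ xs f) _) ⟩
  f x + (∑ xs f + (g x + ∑ xs g))       ≡⟨ +-assoc (f x) (∑ xs f) _ ⟨
  f x + ∑ xs f + (g x + ∑ xs g)         ∎
  where
  open ≡-Reasoning
  x+[y+z]≡y+[x+z] : ∀ x y z → x + (y + z) ≡ y + (x + z)
  x+[y+z]≡y+[x+z] x y z = trans (sym (+-assoc x y z)) (trans (cong (_+ z) (+-comm x y)) (+-assoc y x z))

∑-*ˡ : ∀ k (f : A → ℕ) xs → ∑[ x ∈ xs ] (k * f x) ≡ k * ∑ xs f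
∑-*ˡ k f []       = sym (*-zeroʳ k)
∑-*ˡ k f (x ∷ xs) = trans (cong (k * f x +_) (∑-*ˡ k f xs)) (sym (*-distribˡ-+ k (f x) (∑ xs f)))

∑-const : ∀ k (xs : List A) → ∑[ _ ∈ xs ] k ≡ k * length xs
∑-const k []       = sym (*-zeroʳ k)
∑-const k (x ∷ xs) = trans (cong (k +_) (∑-const k xs)) (sym (*-suc k (length xs)))

∑-++ : ∀ (f : A → ℕ) xs ys → ∑ (xs ++ ys) f ≡ ∑ xs f + ∑ ys f
∑-++ f []       ys = refl
∑-++ f (x ∷ xs) ys = trans (cong (f x +_) (∑-++ f xs ys)) (sym (+-assoc (f x) (∑ xs f) (∑ ys f)))

∑-map : ∀ (f : B → ℕ) (g : A → B) xs → ∑ (map g xs) f ≡ ∑ xs (f ∘ g)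
∑-map f g []       = refl
∑-map f g (x ∷ xs) = cong (f (g x) +_) (∑-map f g xs)

∑-cartesianProduct : ∀ (f : A × B → ℕ) xs ys →
  ∑ (cartesianProduct xs ys) f ≡ ∑[ x ∈ xs ] ∑[ y ∈ ys ] f (x , y)
∑-cartesianProduct f []       ys = refl
∑-cartesianProduct f (x ∷ xs) ys =
  trans (∑-++ f (map (x ,_) ys) (cartesianProduct xs ys))
    (cong₂ _+_ (∑-map f (x ,_) ys) (∑-cartesianProduct f xs ys))

∑-swap : ∀ (f : A → B → ℕ) xs ys →
  ∑[ x ∈ xs ] ∑[ y ∈ ys ] f x y ≡ ∑[ y ∈ ys ] ∑[ x ∈ xs ] f x y
∑-swap f []       ys = sym (∑-const 0 ys)
∑-swap f (x ∷ xs) ys = begin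
  ∑ ys (f x) + ∑[ x ∈ xs ] ∑[ y ∈ ys ] f x y   ≡⟨ cong (∑ ys (f x) +_) (∑-swap f xs ys) ⟩
  ∑ ys (f x) + ∑[ y ∈ ys ] ∑[ x ∈ xs ] f x y   ≡⟨ ∑-+ (f x) (λ y → ∑[ x ∈ xs ] f x y) ys ⟨
  ∑[ y ∈ ys ] (f x y + ∑[ x ∈ xs ] f x y)       ∎
  where open ≡-Reasoning

∑-tabulate : ∀ {k} (g : Fin k → A) (f : A → ℕ) → ∑ (tabulate g) f ≡ ∑ (allFin k) (f ∘ g)
∑-tabulate {k = zero}  g f = refl
∑-tabulate {k = suc k} g f =
  cong (f (g f0) +_) (trans (∑-tabulate (g ∘ fs) f) (sym (∑-tabulate fs (f ∘ g))))

∑-*ʳ : ∀ k (f : A → ℕ) xs → ∑[ x ∈ xs ] (f x * k) ≡ ∑ xs f * k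
∑-*ʳ k f xs = trans (∑-cong xs (λ x → *-comm (f x) k)) (trans (∑-*ˡ k f xs) (*-comm k (∑ xs f)))

length≡∑1 : ∀ (xs : List A) → length xs ≡ ∑[ _ ∈ xs ] 1
length≡∑1 xs = sym (trans (∑-const 1 xs) (*-identityˡ (length xs)))

count≡∑𝟙 : ∀ (p : A → Bool) xs → length (filter (T? ∘ p) xs) ≡ ∑[ x ∈ xs ] 𝟙 (p x)
count≡∑𝟙 p []       = refl
count≡∑𝟙 p (x ∷ xs) with p x
... | true  = cong suc (count≡∑𝟙 p xs)
... | false = count≡∑𝟙 p xs

IsEnumeration : DecidableEquality A → List A → Set
IsEnumeration _≟_ xs = ∀ a → ∑[ x ∈ xs ] 𝟙 ⌊ x ≟ a ⌋ ≡ 1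

⌊⌋-⇔ : ∀ {P Q : Set} → P ⇔ Q → (p? : Dec P) (q? : Dec Q) → ⌊ p? ⌋ ≡ ⌊ q? ⌋
⌊⌋-⇔ P⇔Q p? q? = trans (isYes≗does p?) (trans (does-⇔ P⇔Q p? q?) (sym (isYes≗does q?)))

⌊⌋-true : ∀ {P : Set} (p? : Dec P) → P → ⌊ p? ⌋ ≡ true
⌊⌋-true p? p = trans (isYes≗does p?) (dec-true p? p)

⌊⌋-false : ∀ {P : Set} (p? : Dec P) → ¬ P → ⌊ p? ⌋ ≡ false
⌊⌋-false p? ¬p = trans (isYes≗does p?) (dec-false p? ¬p)

⌊⌋-true⁻¹ : ∀ {P : Set} {p? : Dec P} → ⌊ p? ⌋ ≡ true → P
⌊⌋-true⁻¹ eq = toWitness (subst T (sym eq) _)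

allFin-isEnumeration : ∀ k → IsEnumeration FP._≟_ (allFin k)
allFin-isEnumeration (suc k) f0 =
  cong suc (trans (∑-tabulate {k = k} fs (λ x → 𝟙 ⌊ x FP.≟ f0 ⌋)) (∑-const 0 (allFin k)))
allFin-isEnumeration (suc k) (fs a) =
  trans (∑-tabulate {k = k} fs (λ x → 𝟙 ⌊ x FP.≟ fs a ⌋))
    (trans (∑-cong (allFin k) (λ x → cong 𝟙 (⌊⌋-⇔ (mk⇔ FP.suc-injective (cong fs)) (fs x FP.≟ fs a) (x FP.≟ a))))
    (allFin-isEnumeration k a))

𝟙-≡-dec : ∀ (_≟₁_ : DecidableEquality A) (_≟₂_ : DecidableEquality B) x y a b →
  𝟙 ⌊ ≡-dec _≟₁_ _≟₂_ (x , y) (a , b) ⌋ ≡ 𝟙 ⌊ x ≟₁ a ⌋ * 𝟙 ⌊ y ≟₂ b ⌋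
𝟙-≡-dec _≟₁_ _≟₂_ x y a b = begin
  𝟙 ⌊ ≡-dec _≟₁_ _≟₂_ (x , y) (a , b) ⌋  ≡⟨ cong 𝟙 (⌊⌋-⇔ ,-≡⇔ (≡-dec _≟₁_ _≟₂_ (x , y) (a , b)) x≟a×y≟b) ⟩
  𝟙 ⌊ x≟a×y≟b ⌋                         ≡⟨ cong 𝟙 (trans (isYes≗does x≟a×y≟b)
                                              (sym (cong₂ _∧_ (isYes≗does (x ≟₁ a)) (isYes≗does (y ≟₂ b))))) ⟩
  𝟙 (⌊ x ≟₁ a ⌋ ∧ ⌊ y ≟₂ b ⌋)            ≡⟨ 𝟙-∧ ⌊ x ≟₁ a ⌋ ⌊ y ≟₂ b ⌋ ⟩
  𝟙 ⌊ x ≟₁ a ⌋ * 𝟙 ⌊ y ≟₂ b ⌋            ∎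
  where
  open ≡-Reasoning
  x≟a×y≟b : Dec (x ≡ a × y ≡ b)
  x≟a×y≟b = (x ≟₁ a) ×-dec (y ≟₂ b)
  ,-≡⇔ : (x , y) ≡ (a , b) ⇔ (x ≡ a × y ≡ b)
  ,-≡⇔ = mk⇔ (λ e → cong proj₁ e , cong proj₂ e) (λ (e₁ , e₂) → cong₂ _,_ e₁ e₂)

cartesianProduct-isEnumeration : ∀ {_≟₁_ : DecidableEquality A} {_≟₂_ : DecidableEquality B} {xs ys} →
  IsEnumeration _≟₁_ xs → IsEnumeration _≟₂_ ys →
  IsEnumeration (≡-dec _≟₁_ _≟₂_) (cartesianProduct xs ys)
cartesianProduct-isEnumeration {_≟₁_ = _≟₁_} {_≟₂_} {xs} {ys} enumˣ enumʸ (a , b) = begin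
  ∑ (cartesianProduct xs ys) (λ p → 𝟙 ⌊ ≡-dec _≟₁_ _≟₂_ p (a , b) ⌋)
    ≡⟨ ∑-cartesianProduct _ xs ys ⟩
  ∑[ x ∈ xs ] ∑[ y ∈ ys ] 𝟙 ⌊ ≡-dec _≟₁_ _≟₂_ (x , y) (a , b) ⌋
    ≡⟨ ∑-cong xs (λ x → ∑-cong ys (λ y → 𝟙-≡-dec _≟₁_ _≟₂_ x y a b)) ⟩
  ∑[ x ∈ xs ] ∑[ y ∈ ys ] (𝟙 ⌊ x ≟₁ a ⌋ * 𝟙 ⌊ y ≟₂ b ⌋)
    ≡⟨ ∑-cong xs (λ x → trans (∑-*ˡ (𝟙 ⌊ x ≟₁ a ⌋) _ ys) (cong (𝟙 ⌊ x ≟₁ a ⌋ *_) (enumʸ b))) ⟩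
  ∑[ x ∈ xs ] (𝟙 ⌊ x ≟₁ a ⌋ * 1)
    ≡⟨ trans (∑-cong xs (λ x → *-identityʳ _)) (enumˣ a) ⟩
  1 ∎
  where open ≡-Reasoning

module Enumerated {_≟_ : DecidableEquality A} {xs : List A} (enum : IsEnumeration _≟_ xs) where

  ∑-select : ∀ (f : A → ℕ) a → ∑[ x ∈ xs ] (𝟙 ⌊ x ≟ a ⌋ * f x) ≡ f a
  ∑-select f a = begin
    ∑[ x ∈ xs ] (𝟙 ⌊ x ≟ a ⌋ * f x)  ≡⟨ ∑-cong xs at-a ⟩
    ∑[ x ∈ xs ] (𝟙 ⌊ x ≟ a ⌋ * f a)  ≡⟨ ∑-*ʳ (f a) (λ x → 𝟙 ⌊ x ≟ a ⌋) xs ⟩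
    ∑[ x ∈ xs ] 𝟙 ⌊ x ≟ a ⌋ * f a    ≡⟨ cong (_* f a) (enum a) ⟩
    1 * f a                          ≡⟨ *-identityˡ (f a) ⟩
    f a                              ∎
    where
    open ≡-Reasoning
    at-a : ∀ x → 𝟙 ⌊ x ≟ a ⌋ * f x ≡ 𝟙 ⌊ x ≟ a ⌋ * f a
    at-a x with x ≟ a
    ... | yes refl = refl
    ... | no _     = refl

  enum-sym : ∀ a → ∑[ x ∈ xs ] 𝟙 ⌊ a ≟ x ⌋ ≡ 1
  enum-sym a = trans (∑-cong xs (λ x → cong 𝟙 (⌊⌋-⇔ (mk⇔ sym sym) (a ≟ x) (x ≟ a)))) (enum a)

  ∑-≢ : ∀ a → ∑[ x ∈ xs ] 𝟙 (not ⌊ a ≟ x ⌋) + 1 ≡ length xs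
  ∑-≢ a = begin
    ∑[ x ∈ xs ] 𝟙 (not ⌊ a ≟ x ⌋) + 1                           ≡⟨ cong (∑[ x ∈ xs ] 𝟙 (not ⌊ a ≟ x ⌋) +_) (enum-sym a) ⟨
    ∑[ x ∈ xs ] 𝟙 (not ⌊ a ≟ x ⌋) + ∑[ x ∈ xs ] 𝟙 ⌊ a ≟ x ⌋      ≡⟨ ∑-+ _ _ xs ⟨
    ∑[ x ∈ xs ] (𝟙 (not ⌊ a ≟ x ⌋) + 𝟙 ⌊ a ≟ x ⌋)               ≡⟨ ∑-cong xs (λ x → 𝟙-not ⌊ a ≟ x ⌋) ⟩
    ∑[ _ ∈ xs ] 1                                               ≡⟨ length≡∑1 xs ⟨
    length xs                                                   ∎
    where open ≡-Reasoning

  -- reindexing along an involution σ: both sides equal ∑ y ∑ x [y = σ x] f y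
  ∑-involution : ∀ (σ : A → A) → (∀ x → σ (σ x) ≡ x) → ∀ (f : A → ℕ) →
    ∑[ x ∈ xs ] f (σ x) ≡ ∑ xs f
  ∑-involution σ σσ f = begin
    ∑[ x ∈ xs ] f (σ x)                              ≡⟨ ∑-cong xs (λ x → ∑-select f (σ x)) ⟨
    ∑[ x ∈ xs ] ∑[ y ∈ xs ] (𝟙 ⌊ y ≟ σ x ⌋ * f y)    ≡⟨ ∑-swap _ xs xs ⟩
    ∑[ y ∈ xs ] ∑[ x ∈ xs ] (𝟙 ⌊ y ≟ σ x ⌋ * f y)    ≡⟨ ∑-cong xs (λ y → ∑-cong xs (λ x →
                                                        cong (λ b → 𝟙 b * f y) (⌊⌋-⇔ (σ-swap y x) (y ≟ σ x) (x ≟ σ y)))) ⟩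
    ∑[ y ∈ xs ] ∑[ x ∈ xs ] (𝟙 ⌊ x ≟ σ y ⌋ * f y)    ≡⟨ ∑-cong xs (λ y → ∑-*ʳ (f y) (λ x → 𝟙 ⌊ x ≟ σ y ⌋) xs) ⟩
    ∑[ y ∈ xs ] (∑[ x ∈ xs ] 𝟙 ⌊ x ≟ σ y ⌋ * f y)    ≡⟨ ∑-cong xs (λ y → trans (cong (_* f y) (enum (σ y))) (*-identityˡ (f y))) ⟩
    ∑[ y ∈ xs ] f y                                  ∎
    where
    open ≡-Reasoning
    σ-swap : ∀ y x → (y ≡ σ x) ⇔ (x ≡ σ y)
    σ-swap y x = mk⇔ (λ e → trans (sym (σσ x)) (cong σ (sym e))) (λ e → trans (sym (σσ y)) (cong σ (sym e)))

-- Steiner triple systems on more than four points are not 2-colourable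

private
  [r+b]²≤2[r²+b²]-≤ : ∀ r d → (r + (r + d)) * (r + (r + d)) ≤ 2 * (r * r + (r + d) * (r + d))
  [r+b]²≤2[r²+b²]-≤ r d = subst ((r + (r + d)) * (r + (r + d)) ≤_) (sym (lemma r d)) (m≤m+n _ (d * d))
    where
    lemma : ∀ r d → 2 * (r * r + (r + d) * (r + d)) ≡ (r + (r + d)) * (r + (r + d)) + d * d
    lemma = solve-∀

[r+b]²≤2[r²+b²] : ∀ r b → (r + b) * (r + b) ≤ 2 * (r * r + b * b)
[r+b]²≤2[r²+b²] r b with ≤-total r b
... | inj₁ r≤b with d , refl ← m≤n⇒∃[o]m+o≡n r≤b = [r+b]²≤2[r²+b²]-≤ r d
... | inj₂ b≤r with d , refl ← m≤n⇒∃[o]m+o≡n b≤r =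
  subst₂ (λ u w → u * u ≤ 2 * w) (+-comm b (b + d)) (+-comm (b * b) _) ([r+b]²≤2[r²+b²]-≤ b d)

v²+2v≡3S⇒v≤4 : ∀ v S → v * v + 2 * v ≡ 3 * S → v * v ≤ 2 * S → v ≤ 4
v²+2v≡3S⇒v≤4 zero    S _ _ = z≤n
v²+2v≡3S⇒v≤4 v@(suc _) S e v²≤2S = *-cancelʳ-≤ v 4 v (+-cancelˡ-≤ (2 * (v * v)) (v * v) (4 * v) (begin
  2 * (v * v) + v * v    ≡⟨ lemma₁ (v * v) ⟩
  3 * (v * v)            ≤⟨ *-monoʳ-≤ 3 v²≤2S ⟩
  3 * (2 * S)            ≡⟨ lemma₂ S ⟩
  2 * (3 * S)            ≡⟨ cong (2 *_) e ⟨
  2 * (v * v + 2 * v)    ≡⟨ lemma₃ v ⟩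
  2 * (v * v) + 4 * v    ∎))
  where
  open ≤-Reasoning
  lemma₁ : ∀ x → 2 * x + x ≡ 3 * x
  lemma₁ = solve-∀
  lemma₂ : ∀ x → 3 * (2 * x) ≡ 2 * (3 * x)
  lemma₂ = solve-∀
  lemma₃ : ∀ v → 2 * (v * v + 2 * v) ≡ 2 * (v * v) + 4 * v
  lemma₃ = solve-∀

-- If no triple is monochromatic, then of each two-coloured pair {a, c} exactly one of a and c has the
-- colour of third a c.  Through the involution c ↦ third a c this makes the two-coloured ordered pairs
-- twice as many as the one-coloured ordered pairs of distinct points, that is rb = r(r − 1) + b(b − 1)
-- for colour classes of sizes r and b.  Together with 2(r² + b²) ≥ (r + b)² this bounds r + b by 4.
module SteinerTripleSystem
  {_≟_ : DecidableEquality A} {xs : List A} (enum : IsEnumeration _≟_ xs)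
  (third : A → A → A)
  (third-comm : ∀ a b → third a b ≡ third b a)
  (third-≢ : ∀ {a b} → a ≢ b → third a b ≢ a)
  (third-third : ∀ {a b} → a ≢ b → third a (third a b) ≡ b)
  where

  open Enumerated {_≟_ = _≟_} {xs} enum

  module _ (col : A → Fin 2) (proper : ∀ {a b} → a ≢ b → col a ≡ col b → col (third a b) ≢ col a) where

    private
      same : A → A → Bool
      same a c = ⌊ col a FP.≟ col c ⌋

      v r b S M : ℕ
      v = length xs
      r = ∑[ a ∈ xs ] 𝟙 ⌊ col a FP.≟ f0 ⌋
      b = ∑[ a ∈ xs ] 𝟙 ⌊ col a FP.≟ fs f0 ⌋
      S = ∑[ a ∈ xs ] ∑[ c ∈ xs ] 𝟙 (same a c)
      M = ∑[ a ∈ xs ] ∑[ c ∈ xs ] 𝟙 (not (same a c))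

      pointsAt : A → A → ℕ
      pointsAt a c = 𝟙 (not (same a c)) * 𝟙 (same a (third a c))

      H : ℕ
      H = ∑[ a ∈ xs ] ∑[ c ∈ xs ] pointsAt a c

      same-refl : ∀ a → same a a ≡ true
      same-refl a = ⌊⌋-true (col a FP.≟ col a) refl

      same-sym : ∀ a c → same a c ≡ same c a
      same-sym a c = ⌊⌋-⇔ (mk⇔ sym sym) (col a FP.≟ col c) (col c FP.≟ col a)

      -- of a mixed pair, exactly one point has the colour of a third point
      𝟙-mixed : ∀ (x y z : Fin 2) → 𝟙 (not ⌊ x FP.≟ y ⌋)
        ≡ 𝟙 (not ⌊ x FP.≟ y ⌋) * 𝟙 ⌊ x FP.≟ z ⌋ + 𝟙 (not ⌊ x FP.≟ y ⌋) * 𝟙 ⌊ y FP.≟ z ⌋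
      𝟙-mixed f0      f0      _       = refl
      𝟙-mixed f0      (fs f0) f0      = refl
      𝟙-mixed f0      (fs f0) (fs f0) = refl
      𝟙-mixed (fs f0) f0      f0      = refl
      𝟙-mixed (fs f0) f0      (fs f0) = refl
      𝟙-mixed (fs f0) (fs f0) _       = refl

      M≡H+H : M ≡ H + H
      M≡H+H = begin
        M                                                       ≡⟨ ∑-cong xs (λ a → ∑-cong xs (λ c →
                                                                     𝟙-mixed (col a) (col c) (col (third a c)))) ⟩
        ∑[ a ∈ xs ] ∑[ c ∈ xs ] (pointsAt a c + pointsAt′ a c)  ≡⟨ ∑-cong xs (λ a → ∑-+ (pointsAt a) (pointsAt′ a) xs) ⟩
        ∑[ a ∈ xs ] (∑ xs (pointsAt a) + ∑ xs (pointsAt′ a))    ≡⟨ ∑-+ _ _ xs ⟩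
        H + ∑[ a ∈ xs ] ∑[ c ∈ xs ] pointsAt′ a c               ≡⟨ cong (H +_) (∑-cong xs (λ a → ∑-cong xs (λ c →
                                                                     pointsAt′≡pointsAt a c))) ⟩
        H + ∑[ a ∈ xs ] ∑[ c ∈ xs ] pointsAt c a                ≡⟨ cong (H +_) (∑-swap (λ a c → pointsAt c a) xs xs) ⟩
        H + H                                                   ∎
        where
        open ≡-Reasoning
        pointsAt′ : A → A → ℕ
        pointsAt′ a c = 𝟙 (not (same a c)) * 𝟙 (same c (third a c))
        pointsAt′≡pointsAt : ∀ a c → pointsAt′ a c ≡ pointsAt c a
        pointsAt′≡pointsAt a c =
          cong₂ (λ u t → 𝟙 (not u) * 𝟙 (same c t)) (same-sym a c) (third-comm a c)

      swapAt : A → A → A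
      swapAt a c with c ≟ a
      ... | yes _ = a
      ... | no  _ = third a c

      swapAt-involutive : ∀ a c → swapAt a (swapAt a c) ≡ c
      swapAt-involutive a c with c ≟ a
      ... | yes c≡a with a ≟ a
      ...   | yes _  = sym c≡a
      ...   | no a≢a = ⊥-elim (a≢a refl)
      swapAt-involutive a c | no c≢a with third a c ≟ a
      ...   | yes e = ⊥-elim (third-≢ (c≢a ∘ sym) e)
      ...   | no  _ = third-third (c≢a ∘ sym)

      sameOther : A → A → ℕ
      sameOther a c = 𝟙 (not ⌊ c ≟ a ⌋) * 𝟙 (same a c)

      pointsAt≡sameOther∘swapAt : ∀ a c → pointsAt a c ≡ sameOther a (swapAt a c)
      pointsAt≡sameOther∘swapAt a c with c ≟ a
      ... | yes refl rewrite same-refl a | ⌊⌋-true (a ≟ a) refl = refl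
      ... | no c≢a rewrite ⌊⌋-false (third a c ≟ a) (third-≢ (c≢a ∘ sym)) with same a c in eq
      ...   | true  = sym (trans (+-identityʳ _) (cong 𝟙 (⌊⌋-false (col a FP.≟ col (third a c))
                        (proper (c≢a ∘ sym) (⌊⌋-true⁻¹ eq) ∘ sym))))
      ...   | false = refl

      ∑-pointsAt+1 : ∀ a → ∑ xs (pointsAt a) + 1 ≡ ∑[ c ∈ xs ] 𝟙 (same a c)
      ∑-pointsAt+1 a = begin
        ∑ xs (pointsAt a) + 1
          ≡⟨ cong (_+ 1) (trans (∑-cong xs (pointsAt≡sameOther∘swapAt a))
                                (∑-involution (swapAt a) (swapAt-involutive a) (sameOther a))) ⟩
        ∑ xs (sameOther a) + 1
          ≡⟨ cong (∑ xs (sameOther a) +_) (trans (sym (cong 𝟙 (same-refl a))) (sym (∑-select (λ c → 𝟙 (same a c)) a))) ⟩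
        ∑ xs (sameOther a) + ∑[ c ∈ xs ] (𝟙 ⌊ c ≟ a ⌋ * 𝟙 (same a c))
          ≡⟨ ∑-+ _ _ xs ⟨
        ∑[ c ∈ xs ] (sameOther a c + 𝟙 ⌊ c ≟ a ⌋ * 𝟙 (same a c))
          ≡⟨ ∑-cong xs (λ c → trans (sym (*-distribʳ-+ (𝟙 (same a c)) (𝟙 (not ⌊ c ≟ a ⌋)) _))
                                    (trans (cong (_* 𝟙 (same a c)) (𝟙-not ⌊ c ≟ a ⌋)) (*-identityˡ _))) ⟩
        ∑[ c ∈ xs ] 𝟙 (same a c)
          ∎
        where open ≡-Reasoning

      H+v≡S : H + v ≡ S
      H+v≡S = begin
        H + v                                  ≡⟨ cong (H +_) (length≡∑1 xs) ⟩
        H + ∑[ _ ∈ xs ] 1                      ≡⟨ ∑-+ _ _ xs ⟨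
        ∑[ a ∈ xs ] (∑ xs (pointsAt a) + 1)    ≡⟨ ∑-cong xs ∑-pointsAt+1 ⟩
        S                                      ∎
        where open ≡-Reasoning

      M+S≡v² : M + S ≡ v * v
      M+S≡v² = begin
        M + S                                                  ≡⟨ ∑-+ _ _ xs ⟨
        ∑[ a ∈ xs ] (∑[ c ∈ xs ] 𝟙 (not (same a c)) + ∑[ c ∈ xs ] 𝟙 (same a c))
                                                               ≡⟨ ∑-cong xs (λ a → trans (sym (∑-+ _ _ xs))
                                                                    (trans (∑-cong xs (λ c → 𝟙-not (same a c))) (sym (length≡∑1 xs)))) ⟩
        ∑[ _ ∈ xs ] v                                          ≡⟨ ∑-const v xs ⟩
        v * v                                                  ∎
        where open ≡-Reasoning

      𝟙-≡-Fin2 : ∀ (x y : Fin 2) →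
        𝟙 ⌊ x FP.≟ y ⌋ ≡ 𝟙 ⌊ x FP.≟ f0 ⌋ * 𝟙 ⌊ y FP.≟ f0 ⌋ + 𝟙 ⌊ x FP.≟ fs f0 ⌋ * 𝟙 ⌊ y FP.≟ fs f0 ⌋
      𝟙-≡-Fin2 f0      f0      = refl
      𝟙-≡-Fin2 f0      (fs f0) = refl
      𝟙-≡-Fin2 (fs f0) f0      = refl
      𝟙-≡-Fin2 (fs f0) (fs f0) = refl

      𝟙-Fin2 : ∀ (x : Fin 2) → 𝟙 ⌊ x FP.≟ f0 ⌋ + 𝟙 ⌊ x FP.≟ fs f0 ⌋ ≡ 1
      𝟙-Fin2 f0      = refl
      𝟙-Fin2 (fs f0) = refl

      S≡r²+b² : S ≡ r * r + b * b
      S≡r²+b² = begin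
        S                                        ≡⟨ ∑-cong xs (λ a → trans (∑-cong xs (λ c → 𝟙-≡-Fin2 (col a) (col c)))
                                                      (trans (∑-+ _ _ xs) (cong₂ _+_ (∑-*ˡ (𝟙 ⌊ col a FP.≟ f0 ⌋) (λ c → 𝟙 ⌊ col c FP.≟ f0 ⌋) xs)
                                                                                 (∑-*ˡ (𝟙 ⌊ col a FP.≟ fs f0 ⌋) (λ c → 𝟙 ⌊ col c FP.≟ fs f0 ⌋) xs)))) ⟩
        ∑[ a ∈ xs ] (𝟙 ⌊ col a FP.≟ f0 ⌋ * r + 𝟙 ⌊ col a FP.≟ fs f0 ⌋ * b)
                                                 ≡⟨ trans (∑-+ _ _ xs) (cong₂ _+_ (∑-*ʳ r _ xs) (∑-*ʳ b _ xs)) ⟩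
        r * r + b * b                            ∎
        where open ≡-Reasoning

      r+b≡v : r + b ≡ v
      r+b≡v = trans (sym (∑-+ _ _ xs)) (trans (∑-cong xs (λ a → 𝟙-Fin2 (col a))) (sym (length≡∑1 xs)))

    length≤4 : length xs ≤ 4
    length≤4 = v²+2v≡3S⇒v≤4 v S v²+2v≡3S (subst (λ u → u * u ≤ 2 * S) r+b≡v
                 (subst (λ w → (r + b) * (r + b) ≤ 2 * w) (sym S≡r²+b²) ([r+b]²≤2[r²+b²] r b)))
      where
      open ≡-Reasoning
      v²+2v≡3S : v * v + 2 * v ≡ 3 * S
      v²+2v≡3S = begin
        v * v + 2 * v              ≡⟨ cong (_+ 2 * v) M+S≡v² ⟨
        M + S + 2 * v              ≡⟨ cong₂ (λ m t → m + t + 2 * v) M≡H+H (sym H+v≡S) ⟩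
        H + H + (H + v) + 2 * v    ≡⟨ lemma H v ⟩
        3 * (H + v)                ≡⟨ cong (3 *_) H+v≡S ⟩
        3 * S                      ∎
        where
        lemma : ∀ h v → h + h + (h + v) + 2 * v ≡ 3 * (h + v)
        lemma = solve-∀

-- Face numbers, genus and chromatic numbers

-- 2 + E − (V + F) for V = 6s + 3, E = (3s + 1)(6s + 3), F = (6s + 2)(2s + 1)
euler-arithmetic : ∀ s → 1 ≤ s →
  ((2 + (1 + 3 * s) * (3 + 6 * s)) ∸ (3 + 6 * s + (2 + 6 * s) * (1 + 2 * s))) / 2 ≡ (s * (6 * s ∸ 1)) / 2
euler-arithmetic (suc t) _ =
  cong (_/ 2) (trans (cong (_∸ V+F) (lemma t)) (m+n∸m≡n V+F (suc t * (t + 5 * suc t))))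
  where
  V+F : ℕ
  V+F = 3 + 6 * suc t + (2 + 6 * suc t) * (1 + 2 * suc t)
  lemma : ∀ t → 2 + (1 + 3 * (1 + t)) * (3 + 6 * (1 + t))
              ≡ 3 + 6 * (1 + t) + (2 + 6 * (1 + t)) * (1 + 2 * (1 + t)) + (1 + t) * (t + 5 * (1 + t))
  lemma = solve-∀

module Counting (s : ℕ) (1≤s : 1 ≤ s) where

  open Complex s

  _≟V_ : DecidableEquality (V s)
  _≟V_ = ≡-dec FP._≟_ FP._≟_

  allV-isEnumeration : IsEnumeration _≟V_ (allV s)
  allV-isEnumeration = cartesianProduct-isEnumeration {_≟₁_ = FP._≟_} {FP._≟_} {allFin (N s)} {allFin 3}
    (allFin-isEnumeration (N s)) (allFin-isEnumeration 3)

  open Enumerated {_≟_ = _≟V_} {allV s} allV-isEnumeration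

  numVertices≡ : numVertices s ≡ 3 + 6 * s
  numVertices≡ = begin
    length (allV s)                                   ≡⟨ length≡∑1 (allV s) ⟩
    ∑[ _ ∈ allV s ] 1                                 ≡⟨ ∑-cartesianProduct (λ _ → 1) (allFin (N s)) (allFin 3) ⟩
    ∑[ _ ∈ allFin (N s) ] 3                           ≡⟨ ∑-const 3 (allFin (N s)) ⟩
    3 * length (allFin (N s))                         ≡⟨ cong (3 *_) (length-tabulate {n = N s} (λ x → x)) ⟩
    3 * suc (2 * s)                                   ≡⟨ lemma s ⟩
    3 + 6 * s                                         ∎
    where
    open ≡-Reasoning
    lemma : ∀ s → 3 * suc (2 * s) ≡ 3 + 6 * s
    lemma = solve-∀

  ∑-≢V : ∀ a → ∑[ b ∈ allV s ] 𝟙 (not (a =V b)) ≡ 2 + 6 * s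
  ∑-≢V a = suc-injective (trans (+-comm 1 _) (trans (∑-≢ a) numVertices≡))

  triangle-through : ∀ a b → a ≢ b → T (any (faceB s a b) (allV s))
  triangle-through a b a≢b =
    any-intro (faceB s a b) (∈-allV (third a b)) (Face′⇒Face {a} {b} {third a b} (a≢b , inj₁ refl))

  𝟙-edge : ∀ a b → 𝟙 (edgeB s a b) ≡ 𝟙 (not (a =V b))
  𝟙-edge a b = 𝟙-∧-implied (not (a =V b)) (any (faceB s a b) (allV s)) (triangle-through a b ∘ toWitnessFalse)

  ∑-face-≡ : ∀ a → ∑[ c ∈ allV s ] 𝟙 (faceB s a a c) ≡ 0
  ∑-face-≡ a = trans (∑-cong (allV s) (λ c → 𝟙-false (faceB s a a c) (λ f → proj₁ (Face⇒Face′ {a} {a} {c} f) refl)))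
                     (∑-const 0 (allV s))

  ∑-face-≢ : ∀ a b → a ≢ b → ∑[ c ∈ allV s ] 𝟙 (faceB s a b c) ≡ 2
  ∑-face-≢ a b a≢b = begin
    ∑[ c ∈ allV s ] 𝟙 (faceB s a b c)                                   ≡⟨ ∑-cong (allV s) split ⟩
    ∑[ c ∈ allV s ] (𝟙 (c =V third a b) + 𝟙 (c =V thirdᵀ a b))         ≡⟨ ∑-+ (λ c → 𝟙 (c =V third a b)) (λ c → 𝟙 (c =V thirdᵀ a b)) (allV s) ⟩
    ∑[ c ∈ allV s ] 𝟙 (c =V third a b) + ∑[ c ∈ allV s ] 𝟙 (c =V thirdᵀ a b)
                                                                        ≡⟨ cong₂ _+_ (allV-isEnumeration (third a b))
                                                                                     (allV-isEnumeration (thirdᵀ a b)) ⟩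
    2                                                                   ∎
    where
    open ≡-Reasoning
    split : ∀ c → 𝟙 (faceB s a b c) ≡ 𝟙 (c =V third a b) + 𝟙 (c =V thirdᵀ a b)
    split c = 𝟙-exclusive-∨ (faceB s a b c) (c =V third a b) (c =V thirdᵀ a b)
      (mk⇔ (λ f → Data.Sum.map =V-complete =V-complete (proj₂ (Face⇒Face′ {a} {b} {c} f)))
           (λ u → Face′⇒Face {a} {b} {c} (a≢b , Data.Sum.map =V-sound =V-sound u)))
      (λ u w → third≢thirdᵀ 1≤s a b a≢b (trans (sym (=V-sound u)) (=V-sound w)))

  ∑-face : ∀ a b → ∑[ c ∈ allV s ] 𝟙 (faceB s a b c) ≡ 2 * 𝟙 (not (a =V b))
  ∑-face a b = by-cases (a ≟V b)
    where
    by-cases : (a≟b : Dec (a ≡ b)) → ∑[ c ∈ allV s ] 𝟙 (faceB s a b c) ≡ 2 * 𝟙 (not ⌊ a≟b ⌋)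
    by-cases (yes refl) = ∑-face-≡ a
    by-cases (no a≢b)   = ∑-face-≢ a b a≢b

  ∑∑-≢V : ∀ k → ∑[ a ∈ allV s ] ∑[ b ∈ allV s ] (k * 𝟙 (not (a =V b))) ≡ k * (2 + 6 * s) * (3 + 6 * s)
  ∑∑-≢V k = begin
    ∑[ a ∈ allV s ] ∑[ b ∈ allV s ] (k * 𝟙 (not (a =V b)))  ≡⟨ ∑-cong (allV s) (λ a →
                                                                 trans (∑-*ˡ k _ (allV s)) (cong (k *_) (∑-≢V a))) ⟩
    ∑[ _ ∈ allV s ] (k * (2 + 6 * s))                         ≡⟨ ∑-const (k * (2 + 6 * s)) (allV s) ⟩
    k * (2 + 6 * s) * length (allV s)                         ≡⟨ cong (k * (2 + 6 * s) *_) numVertices≡ ⟩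
    k * (2 + 6 * s) * (3 + 6 * s)                             ∎
    where open ≡-Reasoning

  numEdges≡ : numEdges s ≡ (1 + 3 * s) * (3 + 6 * s)
  numEdges≡ = begin
    count (λ ab → edgeB s (proj₁ ab) (proj₂ ab)) (cartesianProduct (allV s) (allV s)) / 2
      ≡⟨ cong (_/ 2) (count≡∑𝟙 edge (cartesianProduct (allV s) (allV s))) ⟩
    ∑ (cartesianProduct (allV s) (allV s)) (λ ab → 𝟙 (edgeB s (proj₁ ab) (proj₂ ab))) / 2
      ≡⟨ cong (_/ 2) (∑-cartesianProduct (𝟙 ∘ edge) (allV s) (allV s)) ⟩
    ∑[ a ∈ allV s ] ∑[ b ∈ allV s ] 𝟙 (edgeB s a b) / 2
      ≡⟨ cong (_/ 2) (∑-cong (allV s) (λ a → ∑-cong (allV s) (λ b →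
           trans (𝟙-edge a b) (sym (*-identityˡ _))))) ⟩
    ∑[ a ∈ allV s ] ∑[ b ∈ allV s ] (1 * 𝟙 (not (a =V b))) / 2
      ≡⟨ cong (_/ 2) (trans (∑∑-≢V 1) (lemma s)) ⟩
    (1 + 3 * s) * (3 + 6 * s) * 2 / 2
      ≡⟨ m*n/n≡m _ 2 ⟩
    (1 + 3 * s) * (3 + 6 * s)
      ∎
    where
    open ≡-Reasoning
    edge : V s × V s → Bool
    edge (a , b) = edgeB s a b
    lemma : ∀ s → 1 * (2 + 6 * s) * (3 + 6 * s) ≡ (1 + 3 * s) * (3 + 6 * s) * 2
    lemma = solve-∀

  numFaces≡ : numFaces s ≡ (2 + 6 * s) * (1 + 2 * s)
  numFaces≡ = begin
    count (λ abc → faceB s (proj₁ abc) (proj₁ (proj₂ abc)) (proj₂ (proj₂ abc))) V³ / 6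
      ≡⟨ cong (_/ 6) (count≡∑𝟙 face V³) ⟩
    ∑ V³ (λ abc → 𝟙 (faceB s (proj₁ abc) (proj₁ (proj₂ abc)) (proj₂ (proj₂ abc)))) / 6
      ≡⟨ cong (_/ 6) (trans (∑-cartesianProduct (𝟙 ∘ face) (allV s) (cartesianProduct (allV s) (allV s)))
           (∑-cong (allV s) (λ a → ∑-cartesianProduct (λ bc → 𝟙 (face (a , bc))) (allV s) (allV s)))) ⟩
    ∑[ a ∈ allV s ] ∑[ b ∈ allV s ] ∑[ c ∈ allV s ] 𝟙 (faceB s a b c) / 6
      ≡⟨ cong (_/ 6) (∑-cong (allV s) (λ a → ∑-cong (allV s) (∑-face a))) ⟩
    ∑[ a ∈ allV s ] ∑[ b ∈ allV s ] (2 * 𝟙 (not (a =V b))) / 6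
      ≡⟨ cong (_/ 6) (trans (∑∑-≢V 2) (lemma s)) ⟩
    (2 + 6 * s) * (1 + 2 * s) * 6 / 6
      ≡⟨ m*n/n≡m _ 6 ⟩
    (2 + 6 * s) * (1 + 2 * s)
      ∎
    where
    open ≡-Reasoning
    V³ : List (V s × (V s × V s))
    V³ = cartesianProduct (allV s) (cartesianProduct (allV s) (allV s))
    face : V s × (V s × V s) → Bool
    face (a , b , c) = faceB s a b c
    lemma : ∀ s → 2 * (2 + 6 * s) * (3 + 6 * s) ≡ (2 + 6 * s) * (1 + 2 * s) * 6
    lemma = solve-∀

  genus≡ : genus s ≡ (s * (6 * s ∸ 1)) / 2
  genus≡ = trans (cong₂ (λ e vf → ((2 + e) ∸ vf) / 2) numEdges≡ (cong₂ _+_ numVertices≡ numFaces≡))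
                 (euler-arithmetic s 1≤s)

  ≢⇒Edge : ∀ {a b} → a ≢ b → Edge s a b
  ≢⇒Edge {a} {b} a≢b = T-∧⁺ {not (a =V b)} {any (faceB s a b) (allV s)} (fromWitnessFalse a≢b) (triangle-through a b a≢b)

  Edge⇒≢ : ∀ {a b} → Edge s a b → a ≢ b
  Edge⇒≢ {a} {b} e = toWitnessFalse (proj₁ (T-∧⁻ (not (a =V b)) {any (faceB s a b) (allV s)} e))

  -- the 1-skeleton is a complete graph, so its chromatic number is its number of vertices
  chi1-by-enumeration : ∀ {m} → Fin m ↔ V s → chi1Is s m
  chi1-by-enumeration {m} Fin↔V = (from , proper) , fewer-colours
    where
    open Inverse Fin↔V
    from-injective : ∀ {a b} → from a ≡ from b → a ≡ b
    from-injective {a} {b} e = trans (sym (strictlyInverseˡ a)) (trans (cong to e) (strictlyInverseˡ b))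
    proper : ∀ a b → Edge s a b → ¬ from a ≡ from b
    proper a b e = Edge⇒≢ {a} {b} e ∘ from-injective
    to-injective : ∀ {i i′} → to i ≡ to i′ → i ≡ i′
    to-injective {i} {i′} e = trans (sym (strictlyInverseʳ i)) (trans (cong from e) (strictlyInverseʳ i′))
    fewer-colours : ∀ j → j < m → ¬ Proper1 s j
    fewer-colours j j<m (col , ok) = collision (FP.pigeonhole j<m (col ∘ to))
      where
      collision : ¬ ∃₂ λ i i′ → i Data.Fin.< i′ × col (to i) ≡ col (to i′)
      collision (i , i′ , i<i′ , e) = ok (to i) (to i′) (≢⇒Edge {to i} {to i′} (FP.<⇒≢ i<i′ ∘ to-injective)) e

  chi1 : chi1Is s (3 * (2 * s + 1))
  chi1 = chi1-by-enumeration (subst (λ m → Fin m ↔ V s) (lemma s) FP.*↔×)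
    where
    lemma : ∀ s → suc (2 * s) * 3 ≡ 3 * (2 * s + 1)
    lemma = solve-∀

  more-than-4-vertices : ¬ 3 + 6 * s ≤ 4
  more-than-4-vertices le with ≤-trans (+-monoʳ-≤ 3 (*-monoʳ-≤ 6 1≤s)) le
  ... | s≤s (s≤s (s≤s (s≤s ())))

  third-≢ : ∀ {a b} → a ≢ b → third a b ≢ a
  third-≢ a≢b = proj₁ (InB-perm (a≢b , refl) p312)

  third-third : ∀ {a b} → a ≢ b → third a (third a b) ≡ b
  third-third a≢b = sym (proj₂ (InB-swap₂₃ (a≢b , refl)))

  level-third-≢ : ∀ {x₁ x₂} y → x₁ ≢ x₂ → proj₂ (third (x₁ , y) (x₂ , y)) ≢ y
  level-third-≢ l0 ne e with () ← trans (sym (cong proj₂ (third-hor l0 l0 ne))) e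
  level-third-≢ l1 ne e with () ← trans (sym (cong proj₂ (third-hor l1 l1 ne))) e
  level-third-≢ l2 ne e with () ← trans (sym (cong proj₂ (third-hor l2 l2 ne))) e

  level-thirdᵀ-≢ : ∀ {x₁ x₂} y → x₁ ≢ x₂ → proj₂ (thirdᵀ (x₁ , y) (x₂ , y)) ≢ y
  level-thirdᵀ-≢ l0 ne e with () ← trans (sym (cong (proj₂ ∘ τ) (third-hor l0 l0 ne))) e
  level-thirdᵀ-≢ l1 ne e with () ← trans (sym (cong (proj₂ ∘ τ) (third-hor l2 l2 (ne ∘ dec-injective)))) e
  level-thirdᵀ-≢ l2 ne e with () ← trans (sym (cong (proj₂ ∘ τ) (third-hor l1 l1 (ne ∘ dec-injective)))) e

  level-proper : ∀ a b c → Face s a b c → ¬ (proj₂ a ≡ proj₂ b × proj₂ b ≡ proj₂ c)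
  level-proper (x₁ , y) (x₂ , .y) (x₃ , .y) f (refl , refl) = flat (Face⇒Face′ {x₁ , y} {x₂ , y} {x₃ , y} f)
    where
    flat : ¬ Face′ (x₁ , y) (x₂ , y) (x₃ , y)
    flat (a≢b , inj₁ e) = level-third-≢ y (a≢b ∘ cong (_, y)) (sym (cong proj₂ e))
    flat (a≢b , inj₂ e) = level-thirdᵀ-≢ y (a≢b ∘ cong (_, y)) (sym (cong proj₂ e))

  no-proper-2-colouring : ∀ j → j < 3 → ¬ Proper2 s j
  no-proper-2-colouring j (s≤s j≤2) (col , ok) =
    more-than-4-vertices (subst (_≤ 4) numVertices≡ (length≤4 col′ proper))
    where
    open SteinerTripleSystem {_≟_ = _≟V_} {allV s} allV-isEnumeration third third-comm third-≢ third-third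
    col′ : V s → Fin 2
    col′ v = inject≤ (col v) j≤2
    inject≤-injective : ∀ {x y : Fin j} → inject≤ x j≤2 ≡ inject≤ y j≤2 → x ≡ y
    inject≤-injective {x} {y} e = FP.toℕ-injective
      (trans (sym (FP.toℕ-inject≤ x j≤2)) (trans (cong toℕ e) (FP.toℕ-inject≤ y j≤2)))
    proper : ∀ {a b} → a ≢ b → col′ a ≡ col′ b → col′ (third a b) ≢ col′ a
    proper {a} {b} a≢b ab ca = ok a b (third a b) (InB⇒Face {a} {b} {third a b} (a≢b , refl))
      (inject≤-injective ab , inject≤-injective (trans (sym ab) (sym ca)))

  chi2 : chi2Is s 3
  chi2 = (proj₂ , level-proper) , no-proper-2-colouring

-- The horizontal shift and the orientation

module Shift (s : ℕ) where

  open Complex s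

  h : V s → V s
  h = hshift s

  h-injective : ∀ {a b} → h a ≡ h b → a ≡ b
  h-injective {_ , y₁} {_ , y₂} e = cong₂ _,_ (inc-injective (cong proj₁ e)) (cong proj₂ e)

  thirdHor-h : ∀ x₁ y₁ x₂ y₂ → thirdHor (inc x₁) y₁ (inc x₂) y₂ ≡ h (thirdHor x₁ y₁ x₂ y₂)
  thirdHor-h x₁ l0 x₂ l0 = cong (_, l1) (inc-mid x₁ x₂)
  thirdHor-h x₁ l1 x₂ l1 = cong (_, l2) (inc-mid x₁ x₂)
  thirdHor-h x₁ l2 x₂ l2 = cong (_, l0) (inc-mid x₁ x₂)
  thirdHor-h x₁ l0 x₂ l1 = cong (_, l0) (inc-reflect x₂ x₁)
  thirdHor-h x₁ l1 x₂ l2 = cong (_, l1) (inc-reflect x₂ x₁)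
  thirdHor-h x₁ l2 x₂ l0 = cong (_, l2) (inc-reflect x₂ x₁)
  thirdHor-h x₁ l1 x₂ l0 = cong (_, l0) (inc-reflect x₁ x₂)
  thirdHor-h x₁ l2 x₂ l1 = cong (_, l1) (inc-reflect x₁ x₂)
  thirdHor-h x₁ l0 x₂ l2 = cong (_, l2) (inc-reflect x₁ x₂)

  third-h : ∀ a b → third (h a) (h b) ≡ h (third a b)
  third-h (x₁ , y₁) (x₂ , y₂) with inc x₁ FP.≟ inc x₂ | x₁ FP.≟ x₂
  ... | yes _ | yes _ = refl
  ... | yes e | no ne = ⊥-elim (ne (inc-injective e))
  ... | no ne | yes e = ⊥-elim (ne (cong inc e))
  ... | no _  | no _  = thirdHor-h x₁ y₁ x₂ y₂

  τ⁻¹-h : ∀ v → τ⁻¹ (h v) ≡ h (τ⁻¹ v)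
  τ⁻¹-h (x , l0) = refl
  τ⁻¹-h (x , l1) = cong (_, l2) (trans (dec-inc x) (sym (inc-dec x)))
  τ⁻¹-h (x , l2) = cong (_, l1) (trans (dec-inc x) (sym (inc-dec x)))

  τ-h : ∀ v → τ (h v) ≡ h (τ v)
  τ-h (x , l0) = refl
  τ-h (x , l1) = refl
  τ-h (x , l2) = refl

  thirdᵀ-h : ∀ a b → thirdᵀ (h a) (h b) ≡ h (thirdᵀ a b)
  thirdᵀ-h a b = trans (cong τ (trans (cong₂ third (τ⁻¹-h a) (τ⁻¹-h b)) (third-h (τ⁻¹ a) (τ⁻¹ b)))) (τ-h _)

  Face′-h : ∀ {a b c} → Face′ a b c → Face′ (h a) (h b) (h c)
  Face′-h {a} {b} (a≢b , inj₁ e) = a≢b ∘ h-injective , inj₁ (trans (cong h e) (sym (third-h a b)))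
  Face′-h {a} {b} (a≢b , inj₂ e) = a≢b ∘ h-injective , inj₂ (trans (cong h e) (sym (thirdᵀ-h a b)))

  Face′-h⁻¹ : ∀ {a b c} → Face′ (h a) (h b) (h c) → Face′ a b c
  Face′-h⁻¹ {a} {b} (a≢b , inj₁ e) = a≢b ∘ cong h , inj₁ (h-injective (trans e (third-h a b)))
  Face′-h⁻¹ {a} {b} (a≢b , inj₂ e) = a≢b ∘ cong h , inj₂ (h-injective (trans e (thirdᵀ-h a b)))

  h-isAutomorphism : IsAutomorphism s h
  h-isAutomorphism =
    (h⁻¹ , (λ v → cong (_, proj₂ v) (dec-inc (proj₁ v))) , (λ v → cong (_, proj₂ v) (inc-dec (proj₁ v))))
    , (λ a b c f → Face′⇒Face {h a} {h b} {h c} (Face′-h (Face⇒Face′ {a} {b} {c} f)))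
    , (λ a b c f → Face′⇒Face {a} {b} {c} (Face′-h⁻¹ (Face⇒Face′ {h a} {h b} {h c} f)))
    where
    h⁻¹ : V s → V s
    h⁻¹ (x , y) = (dec x , y)

isEven : ℕ → Bool
isEven zero    = true
isEven (suc m) = not (isEven m)

isEven-+ : ∀ a b → isEven (a + b) ≡ not (isEven a xor isEven b)
isEven-+ zero    b = sym (not-involutive (isEven b))
isEven-+ (suc a) b rewrite isEven-+ a b = lemma (isEven a) (isEven b)
  where
  lemma : ∀ x y → not (not (x xor y)) ≡ not (not x xor y)
  lemma true  y = not-involutive (not y)
  lemma false y = refl

isEven-2* : ∀ m → isEven (2 * m) ≡ true
isEven-2* m = trans (cong isEven (cong (m +_) (+-identityʳ m))) (trans (isEven-+ m m) (lemma (isEven m)))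
  where
  lemma : ∀ x → not (x xor x) ≡ true
  lemma true  = refl
  lemma false = refl

isEven-odd-sum : ∀ t r m → t + r ≡ suc (2 * m) → isEven t ≡ not (isEven r)
isEven-odd-sum t r m e = lemma (isEven t) (isEven r)
  (trans (sym (isEven-+ t r)) (trans (cong isEven e) (cong not (isEven-2* m))))
  where
  lemma : ∀ x y → not (x xor y) ≡ false → x ≡ not y
  lemma true  false _ = refl
  lemma false true  _ = refl

module Differences (s : ℕ) where

  open Zmod s

  mid-⊖ : ∀ x₁ x₂ → mid x₁ x₂ ⊖ x₂ ≡ neg (half (x₂ ⊖ x₁))
  mid-⊖ x₁ x₂ = ≡-by-representatives (a * s + 2 * a * s * s + b * s) (a + b)
      (≈-trans (toℕ-⊖ (mid x₁ x₂) x₂) (+-congʳ (2 * s * b) (toℕ-mid x₁ x₂)))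
      (≈-trans (toℕ-neg (half (x₂ ⊖ x₁))) (*-congˡ (2 * s) (≈-trans (toℕ-half (x₂ ⊖ x₁)) (*-congʳ (s + 1) (toℕ-⊖ x₂ x₁)))))
      (lemma a b s)
    where
    a : ℕ
    a = toℕ x₁
    b : ℕ
    b = toℕ x₂
    lemma : ∀ a b s → (a + b) * (s + 1) + 2 * s * b + (a * s + 2 * a * s * s + b * s) * suc (2 * s)
                    ≡ 2 * s * ((b + 2 * s * a) * (s + 1)) + (a + b) * suc (2 * s)
    lemma = solve-∀

  reflect-⊖ : ∀ x₁ x₂ → reflect x₂ x₁ ⊖ x₂ ≡ x₂ ⊖ x₁
  reflect-⊖ x₁ x₂ = ≡-by-representatives 0 b
      (≈-trans (toℕ-⊖ (reflect x₂ x₁) x₂) (+-congʳ (2 * s * b) (toℕ-reflect x₂ x₁))) (toℕ-⊖ x₂ x₁) (lemma a b s)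
    where
    a : ℕ
    a = toℕ x₁
    b : ℕ
    b = toℕ x₂
    lemma : ∀ a b s → 2 * b + 2 * s * a + 2 * s * b + 0 * suc (2 * s) ≡ b + 2 * s * a + b * suc (2 * s)
    lemma = solve-∀

  half-reflect-⊖ : ∀ x₁ x₂ → half (reflect x₁ x₂ ⊖ x₂) ≡ neg (x₂ ⊖ x₁)
  half-reflect-⊖ x₁ x₂ = ≡-by-representatives (2 * a * s) (2 * a + 2 * b * s)
      (≈-trans (toℕ-half (reflect x₁ x₂ ⊖ x₂))
        (*-congʳ (s + 1) (≈-trans (toℕ-⊖ (reflect x₁ x₂) x₂) (+-congʳ (2 * s * b) (toℕ-reflect x₁ x₂)))))
      (≈-trans (toℕ-neg (x₂ ⊖ x₁)) (*-congˡ (2 * s) (toℕ-⊖ x₂ x₁)))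
      (lemma a b s)
    where
    a : ℕ
    a = toℕ x₁
    b : ℕ
    b = toℕ x₂
    lemma : ∀ a b s → (2 * a + 2 * s * b + 2 * s * b) * (s + 1) + 2 * a * s * suc (2 * s)
                    ≡ 2 * s * (b + 2 * s * a) + (2 * a + 2 * b * s) * suc (2 * s)
    lemma = solve-∀

  inc-⊖ : ∀ y x → inc y ⊖ x ≡ inc (y ⊖ x)
  inc-⊖ y x = ≡-by-representatives 0 0
      (≈-trans (toℕ-⊖ (inc y) x) (+-congʳ (2 * s * toℕ x) (toℕ-inc y)))
      (≈-trans (toℕ-inc (y ⊖ x)) (+-congʳ 1 (toℕ-⊖ y x)))
      (lemma (toℕ x) (toℕ y) s)
    where
    lemma : ∀ x y s → y + 1 + 2 * s * x + 0 * suc (2 * s) ≡ y + 2 * s * x + 1 + 0 * suc (2 * s)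
    lemma = solve-∀

  dec-⊖ : ∀ y x → dec y ⊖ x ≡ dec (y ⊖ x)
  dec-⊖ y x = ≡-by-representatives 0 0
      (≈-trans (toℕ-⊖ (dec y) x) (+-congʳ (2 * s * toℕ x) (toℕ-dec y)))
      (≈-trans (toℕ-dec (y ⊖ x)) (+-congʳ (2 * s) (toℕ-⊖ y x)))
      (lemma (toℕ x) (toℕ y) s)
    where
    lemma : ∀ x y s → y + 2 * s + 2 * s * x + 0 * suc (2 * s) ≡ y + 2 * s * x + 2 * s + 0 * suc (2 * s)
    lemma = solve-∀

  inc-⊖-inc : ∀ y x → inc y ⊖ inc x ≡ y ⊖ x
  inc-⊖-inc y x = ≡-by-representatives 0 1
      (≈-trans (toℕ-⊖ (inc y) (inc x)) (+-cong (toℕ-inc y) (*-congˡ (2 * s) (toℕ-inc x))))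
      (toℕ-⊖ y x)
      (lemma (toℕ x) (toℕ y) s)
    where
    lemma : ∀ x y s → y + 1 + 2 * s * (x + 1) + 0 * suc (2 * s) ≡ y + 2 * s * x + 1 * suc (2 * s)
    lemma = solve-∀

  dec-mid : ∀ x y → mid (dec x) (dec y) ≡ dec (mid x y)
  dec-mid x y = ≡-by-representatives 0 (2 * s)
      (≈-trans (toℕ-mid (dec x) (dec y)) (*-congʳ (s + 1) (+-cong (toℕ-dec x) (toℕ-dec y))))
      (≈-trans (toℕ-dec (mid x y)) (+-congʳ (2 * s) (toℕ-mid x y)))
      (lemma (toℕ x) (toℕ y) s)
    where
    lemma : ∀ x y s → (x + 2 * s + (y + 2 * s)) * (s + 1) + 0 * suc (2 * s)
                    ≡ (x + y) * (s + 1) + 2 * s + 2 * s * suc (2 * s)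
    lemma = solve-∀

  reflect-decʳ : ∀ x y → reflect x (dec y) ≡ inc (reflect x y)
  reflect-decʳ x y = ≡-by-representatives 1 (2 * s)
      (≈-trans (toℕ-reflect x (dec y)) (+-congˡ (2 * toℕ x) (*-congˡ (2 * s) (toℕ-dec y))))
      (≈-trans (toℕ-inc (reflect x y)) (+-congʳ 1 (toℕ-reflect x y)))
      (lemma (toℕ x) (toℕ y) s)
    where
    lemma : ∀ x y s → 2 * x + 2 * s * (y + 2 * s) + 1 * suc (2 * s) ≡ 2 * x + 2 * s * y + 1 + 2 * s * suc (2 * s)
    lemma = solve-∀

  reflect-decˡ : ∀ x y → reflect (dec x) y ≡ dec (dec (reflect x y))
  reflect-decˡ x y = ≡-by-representatives 0 0
      (≈-trans (toℕ-reflect (dec x) y) (+-congʳ (2 * s * toℕ y) (*-congˡ 2 (toℕ-dec x))))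
      (≈-trans (toℕ-dec (dec (reflect x y)))
        (+-congʳ (2 * s) (≈-trans (toℕ-dec (reflect x y)) (+-congʳ (2 * s) (toℕ-reflect x y)))))
      (lemma (toℕ x) (toℕ y) s)
    where
    lemma : ∀ x y s → 2 * (x + 2 * s) + 2 * s * y + 0 * suc (2 * s) ≡ 2 * x + 2 * s * y + 2 * s + 2 * s + 0 * suc (2 * s)
    lemma = solve-∀

  dec-reflect : ∀ x y → reflect (dec x) (dec y) ≡ dec (reflect x y)
  dec-reflect x y = ≡-by-representatives 0 (2 * s)
      (≈-trans (toℕ-reflect (dec x) (dec y)) (+-cong (*-congˡ 2 (toℕ-dec x)) (*-congˡ (2 * s) (toℕ-dec y))))
      (≈-trans (toℕ-dec (reflect x y)) (+-congʳ (2 * s) (toℕ-reflect x y)))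
      (lemma (toℕ x) (toℕ y) s)
    where
    lemma : ∀ x y s → 2 * (x + 2 * s) + 2 * s * (y + 2 * s) + 0 * suc (2 * s)
                    ≡ 2 * x + 2 * s * y + 2 * s + 2 * s * suc (2 * s)
    lemma = solve-∀

  half-inc-inc : ∀ w → half (inc (inc w)) ≡ inc (half w)
  half-inc-inc w = ≡-by-representatives 0 1
      (≈-trans (toℕ-half (inc (inc w))) (*-congʳ (s + 1) (≈-trans (toℕ-inc (inc w)) (+-congʳ 1 (toℕ-inc w)))))
      (≈-trans (toℕ-inc (half w)) (+-congʳ 1 (toℕ-half w)))
      (lemma (toℕ w) s)
    where
    lemma : ∀ w s → (w + 1 + 1) * (s + 1) + 0 * suc (2 * s) ≡ w * (s + 1) + 1 + 1 * suc (2 * s)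
    lemma = solve-∀

  half-dec-dec : ∀ w → half (dec (dec w)) ≡ dec (half w)
  half-dec-dec w = ≡-by-representatives 0 (2 * s)
      (≈-trans (toℕ-half (dec (dec w))) (*-congʳ (s + 1) (≈-trans (toℕ-dec (dec w)) (+-congʳ (2 * s) (toℕ-dec w)))))
      (≈-trans (toℕ-dec (half w)) (+-congʳ (2 * s) (toℕ-half w)))
      (lemma (toℕ w) s)
    where
    lemma : ∀ w s → (w + 2 * s + 2 * s) * (s + 1) + 0 * suc (2 * s) ≡ w * (s + 1) + 2 * s + 2 * s * suc (2 * s)
    lemma = solve-∀

  half-neg : ∀ u → half (neg u) ≡ neg (half u)
  half-neg u = ≡-by-representatives 0 0
      (≈-trans (toℕ-half (neg u)) (*-congʳ (s + 1) (toℕ-neg u)))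
      (≈-trans (toℕ-neg (half u)) (*-congˡ (2 * s) (toℕ-half u)))
      (lemma (toℕ u) s)
    where
    lemma : ∀ u s → 2 * s * u * (s + 1) + 0 * suc (2 * s) ≡ 2 * s * (u * (s + 1)) + 0 * suc (2 * s)
    lemma = solve-∀

  ⊖-anticomm : ∀ x₁ x₂ → x₁ ⊖ x₂ ≡ neg (x₂ ⊖ x₁)
  ⊖-anticomm x₁ x₂ = ≡-by-representatives (2 * a * s) a
      (toℕ-⊖ x₁ x₂) (≈-trans (toℕ-neg (x₂ ⊖ x₁)) (*-congˡ (2 * s) (toℕ-⊖ x₂ x₁))) (lemma a b s)
    where
    a : ℕ
    a = toℕ x₁
    b : ℕ
    b = toℕ x₂
    lemma : ∀ a b s → a + 2 * s * b + 2 * a * s * suc (2 * s) ≡ 2 * s * (b + 2 * s * a) + a * suc (2 * s)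
    lemma = solve-∀

  ⊖-self : ∀ x → x ⊖ x ≡ f0
  ⊖-self x = ≈⇒≡ᶻ (≈-trans (toℕ-⊖ x x) (≈-by-multiples 0 (toℕ x) (lemma (toℕ x) s)))
    where
    lemma : ∀ x s → x + 2 * s * x + 0 * suc (2 * s) ≡ 0 + x * suc (2 * s)
    lemma = solve-∀

  ⊖≡0⇒≡ : ∀ x₁ x₂ → x₂ ⊖ x₁ ≡ f0 → x₁ ≡ x₂
  ⊖≡0⇒≡ x₁ x₂ z = sym (≈⇒≡ᶻ (≈-trans (≈-by-multiples (toℕ x₁) 0 (lemma (toℕ x₁) (toℕ x₂) s))
      (+-congʳ (toℕ x₁) (≈-trans (≈-sym (toℕ-⊖ x₂ x₁)) (≡⇒≈ᶻ z)))))
    where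
    lemma : ∀ a b s → b + a * suc (2 * s) ≡ b + 2 * s * a + a + 0 * suc (2 * s)
    lemma = solve-∀

  -- the displacement from x₂ to the third vertex of the B(s)ᵀ-triangle, one identity per pair of levels
  inc-mid-⊖ : ∀ x₁ x₂ → inc (mid x₁ x₂) ⊖ x₂ ≡ inc (neg (half (x₂ ⊖ x₁)))
  inc-mid-⊖ x₁ x₂ = trans (inc-⊖ (mid x₁ x₂) x₂) (cong inc (mid-⊖ x₁ x₂))

  mid-dec-⊖ : ∀ x₁ x₂ → mid (dec x₁) (dec x₂) ⊖ x₂ ≡ dec (neg (half (x₂ ⊖ x₁)))
  mid-dec-⊖ x₁ x₂ = trans (cong (_⊖ x₂) (dec-mid x₁ x₂)) (trans (dec-⊖ (mid x₁ x₂) x₂) (cong dec (mid-⊖ x₁ x₂)))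

  inc-mid-dec-⊖ : ∀ x₁ x₂ → inc (mid (dec x₁) (dec x₂)) ⊖ x₂ ≡ neg (half (x₂ ⊖ x₁))
  inc-mid-dec-⊖ x₁ x₂ = trans (cong (λ z → inc z ⊖ x₂) (dec-mid x₁ x₂))
    (trans (cong (_⊖ x₂) (inc-dec (mid x₁ x₂))) (mid-⊖ x₁ x₂))

  half-inc-reflect-decʳ-⊖ : ∀ x₁ x₂ → half (inc (reflect x₁ (dec x₂)) ⊖ x₂) ≡ inc (neg (x₂ ⊖ x₁))
  half-inc-reflect-decʳ-⊖ x₁ x₂ = trans (cong (λ z → half (inc z ⊖ x₂)) (reflect-decʳ x₁ x₂))
    (trans (cong half (trans (inc-⊖ (inc (reflect x₁ x₂)) x₂) (cong inc (inc-⊖ (reflect x₁ x₂) x₂))))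
      (trans (half-inc-inc (reflect x₁ x₂ ⊖ x₂)) (cong inc (half-reflect-⊖ x₁ x₂))))

  inc-reflect-decʳ-⊖ : ∀ x₁ x₂ → inc (reflect x₂ (dec x₁)) ⊖ x₂ ≡ inc (inc (x₂ ⊖ x₁))
  inc-reflect-decʳ-⊖ x₁ x₂ = trans (cong (λ z → inc z ⊖ x₂) (reflect-decʳ x₂ x₁))
    (trans (inc-⊖ (inc (reflect x₂ x₁)) x₂) (cong inc (trans (inc-⊖ (reflect x₂ x₁) x₂) (cong inc (reflect-⊖ x₁ x₂)))))

  reflect-decˡ-⊖ : ∀ x₁ x₂ → reflect (dec x₂) x₁ ⊖ x₂ ≡ dec (dec (x₂ ⊖ x₁))
  reflect-decˡ-⊖ x₁ x₂ = trans (cong (_⊖ x₂) (reflect-decˡ x₂ x₁))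
    (trans (dec-⊖ (dec (reflect x₂ x₁)) x₂) (cong dec (trans (dec-⊖ (reflect x₂ x₁) x₂) (cong dec (reflect-⊖ x₁ x₂)))))

  half-reflect-decˡ-⊖ : ∀ x₁ x₂ → half (reflect (dec x₁) x₂ ⊖ x₂) ≡ dec (neg (x₂ ⊖ x₁))
  half-reflect-decˡ-⊖ x₁ x₂ = trans (cong (λ z → half (z ⊖ x₂)) (reflect-decˡ x₁ x₂))
    (trans (cong half (trans (dec-⊖ (dec (reflect x₁ x₂)) x₂) (cong dec (dec-⊖ (reflect x₁ x₂) x₂))))
      (trans (half-dec-dec (reflect x₁ x₂ ⊖ x₂)) (cong dec (half-reflect-⊖ x₁ x₂))))

  half-inc-dec-reflect-⊖ : ∀ x₁ x₂ → half (inc (reflect (dec x₁) (dec x₂)) ⊖ x₂) ≡ neg (x₂ ⊖ x₁)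
  half-inc-dec-reflect-⊖ x₁ x₂ = trans (cong (λ z → half (inc z ⊖ x₂)) (dec-reflect x₁ x₂))
    (trans (cong (λ z → half (z ⊖ x₂)) (inc-dec (reflect x₁ x₂))) (half-reflect-⊖ x₁ x₂))

  inc-dec-reflect-⊖ : ∀ x₁ x₂ → inc (reflect (dec x₂) (dec x₁)) ⊖ x₂ ≡ x₂ ⊖ x₁
  inc-dec-reflect-⊖ x₁ x₂ = trans (cong (λ z → inc z ⊖ x₂) (dec-reflect x₂ x₁))
    (trans (cong (_⊖ x₂) (inc-dec (reflect x₂ x₁))) (reflect-⊖ x₁ x₂))

  neg-0 : neg f0 ≡ f0
  neg-0 = ≈⇒≡ᶻ (≈-trans (toℕ-neg f0) (≈-reflexive (*-zeroʳ (2 * s))))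

  half-≢0 : ∀ w → w ≢ f0 → half w ≢ f0
  half-≢0 w w≢0 z = w≢0 (FP.toℕ-injective (≈⇒≡ (FP.toℕ<n w) (s≤s z≤n)
      (≈-trans (≈-by-multiples (toℕ w) 0 (lemma (toℕ w) s))
        (≈-trans (*-congˡ 2 (≈-sym (toℕ-half w))) (≈-reflexive (cong (2 *_) (cong toℕ z)))))))
    where
    lemma : ∀ a s → a + a * suc (2 * s) ≡ 2 * (a * (s + 1)) + 0 * suc (2 * s)
    lemma = solve-∀

  toℕ-inc-⊖ : 1 ≤ s → ∀ x → toℕ (inc x ⊖ x) ≡ 1
  toℕ-inc-⊖ 1≤s x = ≈⇒≡ (FP.toℕ<n (inc x ⊖ x)) (s≤s (≤-trans 1≤s (m≤m+n s _)))
      (≈-trans (toℕ-⊖ (inc x) x) (≈-trans (+-congʳ (2 * s * toℕ x) (toℕ-inc x))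
        (≈-by-multiples 0 (toℕ x) (lemma (toℕ x) s))))
    where
    lemma : ∀ x s → x + 1 + 2 * s * x + 0 * suc (2 * s) ≡ 1 + x * suc (2 * s)
    lemma = solve-∀

  toℕ-dec-⊖ : ∀ x → toℕ (dec x ⊖ x) ≡ 2 * s
  toℕ-dec-⊖ x = ≈⇒≡ (FP.toℕ<n (dec x ⊖ x)) ≤-refl
      (≈-trans (toℕ-⊖ (dec x) x) (≈-trans (+-congʳ (2 * s * toℕ x) (toℕ-dec x))
        (≈-by-multiples 0 (toℕ x) (lemma (toℕ x) s))))
    where
    lemma : ∀ x s → x + 2 * s + 2 * s * x + 0 * suc (2 * s) ≡ 2 * s + x * suc (2 * s)
    lemma = solve-∀

  -- parity of the representative in [0, 2s]; it flips under x ↦ −x and x ↦ x ± 1 away from the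
  -- wrap-around, because the modulus is odd
  Even : ZN s → Bool
  Even w = isEven (toℕ w)

  IsZero : ZN s → Bool
  IsZero f0     = true
  IsZero (fs _) = false

  IsZero-≢0 : ∀ {w} → w ≢ f0 → IsZero w ≡ false
  IsZero-≢0 {f0}   w≢0 = ⊥-elim (w≢0 refl)
  IsZero-≢0 {fs _} _   = refl

  IsZero-true : ∀ {w} → IsZero w ≡ true → w ≡ f0
  IsZero-true {f0} _ = refl

  toℕ-neg-≢0 : ∀ w → w ≢ f0 → toℕ (neg w) + toℕ w ≡ n
  toℕ-neg-≢0 w w≢0 = trans (cong (_+ toℕ w) neg≡t) t+w≡n
    where
    t : ℕ
    t = n ∸ toℕ w
    t+w≡n : t + toℕ w ≡ n
    t+w≡n = m∸n+n≡m (<⇒≤ (FP.toℕ<n w))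
    t<n : t < n
    t<n = ∸-monoʳ-< {o = 0} (n≢0⇒n>0 (w≢0 ∘ FP.toℕ-injective)) (<⇒≤ (FP.toℕ<n w))
    neg≡t : toℕ (neg w) ≡ t
    neg≡t = ≈⇒≡ (FP.toℕ<n (neg w)) t<n (≈-trans (toℕ-neg w) (+-cancelʳ-≈ (toℕ w)
      (≈-trans (≈-by-multiples 1 (toℕ w) (lemma (toℕ w) s)) (≈-reflexive (sym t+w≡n)))))
      where
      lemma : ∀ a s → 2 * s * a + a + 1 * suc (2 * s) ≡ suc (2 * s) + a * suc (2 * s)
      lemma = solve-∀

  Even-neg : ∀ w → w ≢ f0 → Even (neg w) ≡ not (Even w)
  Even-neg w w≢0 = isEven-odd-sum (toℕ (neg w)) (toℕ w) s (toℕ-neg-≢0 w w≢0)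

  neg-≢0 : ∀ w → w ≢ f0 → neg w ≢ f0
  neg-≢0 w w≢0 neg≡0 = <-irrefl (trans (sym (cong (_+ toℕ w) (cong toℕ neg≡0))) (toℕ-neg-≢0 w w≢0)) (FP.toℕ<n w)

  toℕ-inc-≢2s : ∀ w → toℕ w ≢ 2 * s → toℕ (inc w) ≡ suc (toℕ w)
  toℕ-inc-≢2s w w≢2s = ≈⇒≡ (FP.toℕ<n (inc w)) (s≤s (≤∧≢⇒< (≤-pred (FP.toℕ<n w)) w≢2s))
    (≈-trans (toℕ-inc w) (≈-reflexive (+-comm (toℕ w) 1)))

  Even-inc : ∀ w → toℕ w ≢ 2 * s → Even (inc w) ≡ not (Even w)
  Even-inc w w≢2s = cong isEven (toℕ-inc-≢2s w w≢2s)

  inc-≢0 : ∀ w → toℕ w ≢ 2 * s → inc w ≢ f0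
  inc-≢0 w w≢2s inc≡0 with () ← trans (sym (toℕ-inc-≢2s w w≢2s)) (cong toℕ inc≡0)

  inc-2s : ∀ w → toℕ w ≡ 2 * s → inc w ≡ f0
  inc-2s w w≡2s = ≈⇒≡ᶻ (≈-trans (toℕ-inc w) (≈-trans (≈-reflexive (cong (_+ 1) w≡2s))
    (≈-by-multiples 0 1 (lemma s))))
    where
    lemma : ∀ s → 2 * s + 1 + 0 * suc (2 * s) ≡ 0 + 1 * suc (2 * s)
    lemma = solve-∀

  Even-dec : ∀ w → w ≢ f0 → Even (dec w) ≡ not (Even w)
  Even-dec w w≢0 = dec-parity (toℕ w) refl
    where
    dec-parity : ∀ t → toℕ w ≡ t → Even (dec w) ≡ not (isEven t)
    dec-parity zero    w≡0 = ⊥-elim (w≢0 (FP.toℕ-injective w≡0))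
    dec-parity (suc r) w≡1+r = trans (cong isEven toℕ-dec≡r) (sym (not-involutive (isEven r)))
      where
      toℕ-dec≡r : toℕ (dec w) ≡ r
      toℕ-dec≡r = ≈⇒≡ (FP.toℕ<n (dec w)) (≤-trans (n≤1+n (suc r)) (subst (_< n) w≡1+r (FP.toℕ<n w)))
        (≈-trans (toℕ-dec w) (≈-trans (≈-reflexive (cong (_+ 2 * s) w≡1+r)) (≈-by-multiples 0 1 (lemma r s))))
        where
        lemma : ∀ r s → suc r + 2 * s + 0 * suc (2 * s) ≡ r + 1 * suc (2 * s)
        lemma = solve-∀

  toℕ-dec-0 : toℕ (dec f0) ≡ 2 * s
  toℕ-dec-0 = ≈⇒≡ (FP.toℕ<n (dec f0)) ≤-refl (toℕ-dec f0)

  Even-2s : ∀ w → toℕ w ≡ 2 * s → Even w ≡ true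
  Even-2s w w≡2s = trans (cong isEven w≡2s) (isEven-2* s)

module Orientation (s : ℕ) (1≤s : 1 ≤ s) where

  open Complex s
  open Differences s
  open Shift s

  zeroOrOdd nonzeroEven : ZN s → Bool
  zeroOrOdd w = IsZero w ∨ not (Even w)
  nonzeroEven w = not (IsZero w) ∧ Even w

  zeroOrOdd⁺ : ∀ w → IsZero w ≡ true ⊎ Even w ≡ false → T (zeroOrOdd w)
  zeroOrOdd⁺ w = lemma (IsZero w) (Even w)
    where
    lemma : ∀ z e → z ≡ true ⊎ e ≡ false → T (z ∨ not e)
    lemma true  _     _ = _
    lemma false false _ = _
    lemma false true  (inj₁ ())
    lemma false true  (inj₂ ())

  zeroOrOdd⁻ : ∀ w → IsZero w ≡ false → T (zeroOrOdd w) → Even w ≡ false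
  zeroOrOdd⁻ w = lemma (IsZero w) (Even w)
    where
    lemma : ∀ z e → z ≡ false → T (z ∨ not e) → e ≡ false
    lemma false false _ _ = refl

  ¬zeroOrOdd⁺ : ∀ w → IsZero w ≡ false → Even w ≡ true → T (not (zeroOrOdd w))
  ¬zeroOrOdd⁺ w = lemma (IsZero w) (Even w)
    where
    lemma : ∀ z e → z ≡ false → e ≡ true → T (not (z ∨ not e))
    lemma false true _ _ = _

  ¬zeroOrOdd⁻ : ∀ w → T (not (zeroOrOdd w)) → IsZero w ≡ false × Even w ≡ true
  ¬zeroOrOdd⁻ w = lemma (IsZero w) (Even w)
    where
    lemma : ∀ z e → T (not (z ∨ not e)) → z ≡ false × e ≡ true
    lemma false true _ = refl , refl

  nonzeroEven⁺ : ∀ w → IsZero w ≡ false → Even w ≡ true → T (nonzeroEven w)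
  nonzeroEven⁺ w = lemma (IsZero w) (Even w)
    where
    lemma : ∀ z e → z ≡ false → e ≡ true → T (not z ∧ e)
    lemma false true _ _ = _

  nonzeroEven⁻ : ∀ w → T (nonzeroEven w) → IsZero w ≡ false × Even w ≡ true
  nonzeroEven⁻ w = lemma (IsZero w) (Even w)
    where
    lemma : ∀ z e → T (not z ∧ e) → z ≡ false × e ≡ true
    lemma false true _ = refl , refl

  ¬nonzeroEven⁺ : ∀ w → IsZero w ≡ true ⊎ Even w ≡ false → T (not (nonzeroEven w))
  ¬nonzeroEven⁺ w = lemma (IsZero w) (Even w)
    where
    lemma : ∀ z e → z ≡ true ⊎ e ≡ false → T (not (not z ∧ e))
    lemma true  _     _ = _
    lemma false false _ = _
    lemma false true  (inj₁ ())
    lemma false true  (inj₂ ())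

  ¬nonzeroEven⁻ : ∀ w → T (not (nonzeroEven w)) → IsZero w ≡ true ⊎ Even w ≡ false
  ¬nonzeroEven⁻ w = lemma (IsZero w) (Even w)
    where
    lemma : ∀ z e → T (not (not z ∧ e)) → z ≡ true ⊎ e ≡ false
    lemma true  _     _ = inj₁ refl
    lemma false false _ = inj₂ refl

  -- forward a b says that the B(s)-triangle on the edge ab is oriented (a, b, third a b); the
  -- B(s)ᵀ-triangle on ab then gets the opposite direction of ab.  It only depends on the levels
  -- and on the displacement x₂ − x₁, which makes it invariant under the shift.
  orientation : Fin 3 → Fin 3 → ZN s → Bool
  orientation l0 l0 u = Even (half u)
  orientation l1 l1 u = not (Even (half u))
  orientation l2 l2 u = not (Even (half u))
  orientation l0 l1 u = zeroOrOdd u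
  orientation l0 l2 u = nonzeroEven u
  orientation l1 l0 u = not (Even u)
  orientation l2 l0 u = Even u
  orientation l1 l2 u = Even u
  orientation l2 l1 u = nonzeroEven u

  forward : V s → V s → Bool
  forward (x₁ , y₁) (x₂ , y₂) = orientation y₁ y₂ (x₂ ⊖ x₁)

  ⊖-≢0 : ∀ {x₁ x₂} → x₁ ≢ x₂ → x₂ ⊖ x₁ ≢ f0
  ⊖-≢0 {x₁} {x₂} x₁≢x₂ = x₁≢x₂ ∘ ⊖≡0⇒≡ x₁ x₂

  Even-self : ∀ x → Even (x ⊖ x) ≡ true
  Even-self x = cong Even (⊖-self x)

  IsZero-self : ∀ x → IsZero (x ⊖ x) ≡ true
  IsZero-self x = cong IsZero (⊖-self x)

  Even-neg-half : ∀ u → u ≢ f0 → Even (neg (half u)) ≡ not (Even (half u))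
  Even-neg-half u u≢0 = Even-neg (half u) (half-≢0 u u≢0)

  Even-inc-⊖ : ∀ x → Even (inc x ⊖ x) ≡ false
  Even-inc-⊖ x = cong isEven (toℕ-inc-⊖ 1≤s x)

  Even-dec-⊖ : ∀ x → Even (dec x ⊖ x) ≡ true
  Even-dec-⊖ x = Even-2s (dec x ⊖ x) (toℕ-dec-⊖ x)

  Even-false⇒≢0 : ∀ {w} → Even w ≡ false → w ≢ f0
  Even-false⇒≢0 () refl

  IsZero-false⇒≢0 : ∀ {w} → IsZero w ≡ false → w ≢ f0
  IsZero-false⇒≢0 () refl

  Even-false⇒≢2s : ∀ w → Even w ≡ false → toℕ w ≢ 2 * s
  Even-false⇒≢2s w odd w≡2s with () ← trans (sym odd) (Even-2s w w≡2s)

  inc-even : ∀ v → Even v ≡ true → inc v ≡ f0 ⊎ Even (inc v) ≡ false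
  inc-even v even with toℕ v ≟ 2 * s
  ... | yes v≡2s = inj₁ (inc-2s v v≡2s)
  ... | no  v≢2s = inj₂ (trans (Even-inc v v≢2s) (cong not even))

  Even-mid-⊖ : ∀ {x₁ x₂} → x₁ ≢ x₂ → Even (mid x₁ x₂ ⊖ x₂) ≡ not (Even (half (x₂ ⊖ x₁)))
  Even-mid-⊖ {x₁} {x₂} x₁≢x₂ = trans (cong Even (mid-⊖ x₁ x₂)) (Even-neg-half (x₂ ⊖ x₁) (⊖-≢0 x₁≢x₂))

  Even-half-reflect-⊖ : ∀ {x₁ x₂} → x₁ ≢ x₂ → Even (half (reflect x₁ x₂ ⊖ x₂)) ≡ not (Even (x₂ ⊖ x₁))
  Even-half-reflect-⊖ {x₁} {x₂} x₁≢x₂ = trans (cong Even (half-reflect-⊖ x₁ x₂)) (Even-neg (x₂ ⊖ x₁) (⊖-≢0 x₁≢x₂))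

  forward-third : ∀ a b → a ≢ b → T (forward a b) → T (forward b (third a b))
  forward-third (x₁ , l0) (x₂ , l0) a≢b t with x₁ FP.≟ x₂
  ... | yes refl = ⊥-elim (a≢b refl)
  ... | no x₁≢x₂ = zeroOrOdd⁺ (mid x₁ x₂ ⊖ x₂) (inj₂ (trans (Even-mid-⊖ x₁≢x₂) (cong not (T⇒≡true t))))
  forward-third (x₁ , l1) (x₂ , l1) a≢b t with x₁ FP.≟ x₂
  ... | yes refl = ⊥-elim (a≢b refl)
  ... | no x₁≢x₂ = ≡true⇒T (trans (Even-mid-⊖ x₁≢x₂) (cong not (T-not⇒≡false t)))
  forward-third (x₁ , l2) (x₂ , l2) a≢b t with x₁ FP.≟ x₂
  ... | yes refl = ⊥-elim (a≢b refl)
  ... | no x₁≢x₂ = ≡true⇒T (trans (Even-mid-⊖ x₁≢x₂) (cong not (T-not⇒≡false t)))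
  forward-third (x₁ , l0) (x₂ , l1) a≢b t with x₁ FP.≟ x₂
  ... | yes refl = ≡true⇒T (Even-self x₁)
  ... | no x₁≢x₂ = ≡false⇒T-not (trans (cong Even (reflect-⊖ x₁ x₂))
                     (zeroOrOdd⁻ (x₂ ⊖ x₁) (IsZero-≢0 (⊖-≢0 x₁≢x₂)) t))
  forward-third (x₁ , l1) (x₂ , l2) a≢b t with x₁ FP.≟ x₂
  ... | yes refl = ≡true⇒T (Even-self x₁)
  ... | no x₁≢x₂ = nonzeroEven⁺ (reflect x₂ x₁ ⊖ x₂) (trans (cong IsZero (reflect-⊖ x₁ x₂)) (IsZero-≢0 (⊖-≢0 x₁≢x₂)))
                     (trans (cong Even (reflect-⊖ x₁ x₂)) (T⇒≡true t))
  forward-third (x₁ , l2) (x₂ , l0) a≢b t with x₁ FP.≟ x₂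
  ... | yes refl = zeroOrOdd⁺ (x₁ ⊖ x₁) (inj₁ (IsZero-self x₁))
  ... | no x₁≢x₂ = nonzeroEven⁺ (reflect x₂ x₁ ⊖ x₂) (trans (cong IsZero (reflect-⊖ x₁ x₂)) (IsZero-≢0 (⊖-≢0 x₁≢x₂)))
                     (trans (cong Even (reflect-⊖ x₁ x₂)) (T⇒≡true t))
  forward-third (x₁ , l1) (x₂ , l0) a≢b t with x₁ FP.≟ x₂
  ... | yes refl = ⊥-elim (T-contradiction (≡true⇒T (Even-self x₁)) t)
  ... | no x₁≢x₂ = ≡true⇒T (trans (Even-half-reflect-⊖ x₁≢x₂) (cong not (T-not⇒≡false t)))
  forward-third (x₁ , l2) (x₂ , l1) a≢b t with x₁ FP.≟ x₂
  ... | yes refl = ⊥-elim (IsZero-false⇒≢0 (proj₁ (nonzeroEven⁻ (x₁ ⊖ x₁) t)) (⊖-self x₁))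
  ... | no x₁≢x₂ = ≡false⇒T-not (trans (Even-half-reflect-⊖ x₁≢x₂) (cong not (proj₂ (nonzeroEven⁻ (x₂ ⊖ x₁) t))))
  forward-third (x₁ , l0) (x₂ , l2) a≢b t with x₁ FP.≟ x₂
  ... | yes refl = ⊥-elim (IsZero-false⇒≢0 (proj₁ (nonzeroEven⁻ (x₁ ⊖ x₁) t)) (⊖-self x₁))
  ... | no x₁≢x₂ = ≡false⇒T-not (trans (Even-half-reflect-⊖ x₁≢x₂) (cong not (proj₂ (nonzeroEven⁻ (x₂ ⊖ x₁) t))))

  private
    ≡dec⇒≡inc : ∀ {x₁ x₂} → x₁ ≡ dec x₂ → x₂ ≡ inc x₁
    ≡dec⇒≡inc {x₁} {x₂} e = trans (sym (inc-dec x₂)) (cong inc (sym e))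

  backward-thirdᵀ-l0 : ∀ x₁ x₂ y₂ → (x₁ , l0) ≢ (x₂ , y₂) → T (not (forward (x₁ , l0) (x₂ , y₂))) →
    T (not (forward (x₂ , y₂) (thirdᵀ (x₁ , l0) (x₂ , y₂))))
  backward-thirdᵀ-l0 x₁ x₂ l0 a≢b t with x₁ FP.≟ x₂
  ... | yes refl = ⊥-elim (a≢b refl)
  ... | no x₁≢x₂ = ¬nonzeroEven⁺ w (wrap (inc-even v (trans (Even-neg-half u (⊖-≢0 x₁≢x₂)) (cong not (T-not⇒≡false t)))))
    where
    u v w : ZN s
    u = x₂ ⊖ x₁
    v = neg (half u)
    w = inc (mid x₁ x₂) ⊖ x₂
    wrap : inc v ≡ f0 ⊎ Even (inc v) ≡ false → IsZero w ≡ true ⊎ Even w ≡ false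
    wrap (inj₁ z)   = inj₁ (trans (cong IsZero (inc-mid-⊖ x₁ x₂)) (cong IsZero z))
    wrap (inj₂ odd) = inj₂ (trans (cong Even (inc-mid-⊖ x₁ x₂)) odd)
  backward-thirdᵀ-l0 x₁ x₂ l1 a≢b t with x₁ FP.≟ dec x₂
  ... | yes e = ⊥-elim (T-contradiction (≡true⇒T (proj₂ (¬zeroOrOdd⁻ (inc x₁ ⊖ x₁)
                  (subst (λ z → T (not (zeroOrOdd (z ⊖ x₁)))) (≡dec⇒≡inc {x₁} {x₂} e) t))))
                  (≡false⇒T-not (Even-inc-⊖ x₁)))
  ... | no _ = T-not-not⁺ (≡true⇒T (trans (cong Even (half-inc-reflect-decʳ-⊖ x₁ x₂))
                 (trans (Even-inc (neg u) (Even-false⇒≢2s (neg u) neg-u-odd)) (cong not neg-u-odd))))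
    where
    u : ZN s
    u = x₂ ⊖ x₁
    neg-u-odd : Even (neg u) ≡ false
    neg-u-odd with ¬zeroOrOdd⁻ u t
    ... | u≢0 , u-even = trans (Even-neg u (IsZero-false⇒≢0 u≢0)) (cong not u-even)
  backward-thirdᵀ-l0 x₁ x₂ l2 a≢b t with x₁ FP.≟ dec x₂
  ... | yes e = ¬nonzeroEven⁺ (inc x₁ ⊖ x₂)
                  (inj₁ (cong IsZero (trans (cong (_⊖ x₂) (sym (≡dec⇒≡inc {x₁} {x₂} e))) (⊖-self x₂))))
  ... | no x₁≢dx₂ = ≡false⇒T-not (trans (cong Even (reflect-decˡ-⊖ x₁ x₂)) (odd (¬nonzeroEven⁻ u t)))
    where
    u : ZN s
    u = x₂ ⊖ x₁
    dec-u≢0 : dec u ≢ f0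
    dec-u≢0 d = x₁≢dx₂ (⊖≡0⇒≡ x₁ (dec x₂) (trans (dec-⊖ x₂ x₁) d))
    odd : IsZero u ≡ true ⊎ Even u ≡ false → Even (dec (dec u)) ≡ false
    odd (inj₁ z) = trans (Even-dec (dec u) dec-u≢0)
      (cong not (Even-2s (dec u) (trans (cong (toℕ ∘ dec) (IsZero-true z)) toℕ-dec-0)))
    odd (inj₂ u-odd) = trans (Even-dec (dec u) dec-u≢0)
      (cong not (trans (Even-dec u (Even-false⇒≢0 u-odd)) (cong not u-odd)))

  backward-thirdᵀ-l1 : ∀ x₁ x₂ y₂ → (x₁ , l1) ≢ (x₂ , y₂) → T (not (forward (x₁ , l1) (x₂ , y₂))) →
    T (not (forward (x₂ , y₂) (thirdᵀ (x₁ , l1) (x₂ , y₂))))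
  backward-thirdᵀ-l1 x₁ x₂ l1 a≢b t with dec x₁ FP.≟ dec x₂
  ... | yes e = ⊥-elim (a≢b (cong (_, l1) (dec-injective e)))
  ... | no dx₁≢dx₂ = T-not-not⁺ (≡true⇒T (trans (cong Even (mid-dec-⊖ x₁ x₂)) (trans (Even-dec v v≢0) (cong not v-odd))))
    where
    u≢0 : x₂ ⊖ x₁ ≢ f0
    u≢0 = ⊖-≢0 {x₁} {x₂} (dx₁≢dx₂ ∘ cong dec)
    v : ZN s
    v = neg (half (x₂ ⊖ x₁))
    v≢0 : v ≢ f0
    v≢0 = neg-≢0 (half (x₂ ⊖ x₁)) (half-≢0 (x₂ ⊖ x₁) u≢0)
    v-odd : Even v ≡ false
    v-odd = trans (Even-neg-half (x₂ ⊖ x₁) u≢0) (cong not (T-not-not⁻ t))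
  backward-thirdᵀ-l1 x₁ x₂ l0 a≢b t with dec x₁ FP.≟ x₂
  ... | yes refl = ¬nonzeroEven⁺ (inc (dec x₁) ⊖ dec x₁) (inj₂ (Even-inc-⊖ (dec x₁)))
  ... | no dx₁≢x₂ = ¬zeroOrOdd⁺ (inc (reflect x₂ (dec x₁)) ⊖ x₂)
                      (trans (cong IsZero (inc-reflect-decʳ-⊖ x₁ x₂)) (IsZero-≢0 (inc-≢0 (inc u) inc-u≢2s)))
                      (trans (cong Even (inc-reflect-decʳ-⊖ x₁ x₂)) (trans (Even-inc (inc u) inc-u≢2s) (cong not inc-u-odd)))
    where
    u : ZN s
    u = x₂ ⊖ x₁
    u≢2s : toℕ u ≢ 2 * s
    u≢2s u≡2s = dx₁≢x₂ (trans (cong dec (⊖≡0⇒≡ x₁ (inc x₂) (trans (inc-⊖ x₂ x₁) (inc-2s u u≡2s)))) (dec-inc x₂))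
    inc-u-odd : Even (inc u) ≡ false
    inc-u-odd = trans (Even-inc u u≢2s) (cong not (T-not-not⁻ t))
    inc-u≢2s : toℕ (inc u) ≢ 2 * s
    inc-u≢2s = Even-false⇒≢2s (inc u) inc-u-odd
  backward-thirdᵀ-l1 x₁ x₂ l2 a≢b t with dec x₁ FP.≟ dec x₂
  ... | yes e = ⊥-elim (T-contradiction {Even (x₂ ⊖ x₁)}
                  (≡true⇒T (trans (cong (λ z → Even (x₂ ⊖ z)) (dec-injective e)) (Even-self x₂))) t)
  ... | no dx₁≢dx₂ = T-not-not⁺ (≡true⇒T (trans (cong Even (half-inc-dec-reflect-⊖ x₁ x₂))
                       (trans (Even-neg (x₂ ⊖ x₁) (⊖-≢0 {x₁} {x₂} (dx₁≢dx₂ ∘ cong dec))) (cong not (T-not⇒≡false t)))))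

  backward-thirdᵀ-l2 : ∀ x₁ x₂ y₂ → (x₁ , l2) ≢ (x₂ , y₂) → T (not (forward (x₁ , l2) (x₂ , y₂))) →
    T (not (forward (x₂ , y₂) (thirdᵀ (x₁ , l2) (x₂ , y₂))))
  backward-thirdᵀ-l2 x₁ x₂ l2 a≢b t with dec x₁ FP.≟ dec x₂
  ... | yes e = ⊥-elim (a≢b (cong (_, l2) (dec-injective e)))
  ... | no dx₁≢dx₂ = ¬nonzeroEven⁺ (inc (mid (dec x₁) (dec x₂)) ⊖ x₂) (inj₂ (trans (cong Even (inc-mid-dec-⊖ x₁ x₂))
                       (trans (Even-neg-half (x₂ ⊖ x₁) (⊖-≢0 {x₁} {x₂} (dx₁≢dx₂ ∘ cong dec))) (cong not (T-not-not⁻ t)))))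
  backward-thirdᵀ-l2 x₁ x₂ l0 a≢b t with dec x₁ FP.≟ x₂
  ... | yes refl = ⊥-elim (T-contradiction {Even (dec x₁ ⊖ x₁)} (≡true⇒T (Even-dec-⊖ x₁)) t)
  ... | no _ = ≡false⇒T-not (trans (cong Even (half-reflect-decˡ-⊖ x₁ x₂))
                 (trans (Even-dec (neg u) (neg-≢0 u u≢0)) (cong not (trans (Even-neg u u≢0) (cong not u-odd)))))
    where
    u : ZN s
    u = x₂ ⊖ x₁
    u-odd : Even u ≡ false
    u-odd = T-not⇒≡false t
    u≢0 : u ≢ f0
    u≢0 = Even-false⇒≢0 u-odd
  backward-thirdᵀ-l2 x₁ x₂ l1 a≢b t with dec x₁ FP.≟ dec x₂
  ... | yes e = T-not-not⁺ (≡true⇒T (trans (cong (λ z → Even (dec x₁ ⊖ z)) (sym (dec-injective e))) (Even-dec-⊖ x₁)))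
  ... | no dx₁≢dx₂ = ≡false⇒T-not (trans (cong Even (inc-dec-reflect-⊖ x₁ x₂)) (odd (¬nonzeroEven⁻ (x₂ ⊖ x₁) t)))
    where
    odd : IsZero (x₂ ⊖ x₁) ≡ true ⊎ Even (x₂ ⊖ x₁) ≡ false → Even (x₂ ⊖ x₁) ≡ false
    odd (inj₁ z)      = ⊥-elim (⊖-≢0 {x₁} {x₂} (dx₁≢dx₂ ∘ cong dec) (IsZero-true z))
    odd (inj₂ u-odd)  = u-odd

  backward-thirdᵀ : ∀ a b → a ≢ b → T (not (forward a b)) → T (not (forward b (thirdᵀ a b)))
  backward-thirdᵀ (x₁ , l0) (x₂ , y₂) = backward-thirdᵀ-l0 x₁ x₂ y₂
  backward-thirdᵀ (x₁ , l1) (x₂ , y₂) = backward-thirdᵀ-l1 x₁ x₂ y₂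
  backward-thirdᵀ (x₁ , l2) (x₂ , y₂) = backward-thirdᵀ-l2 x₁ x₂ y₂

  forward-anti : ∀ a b → a ≢ b → forward b a ≡ not (forward a b)
  forward-anti (x₁ , y₁) (x₂ , y₂) a≢b = trans (cong (orientation y₂ y₁) (⊖-anticomm x₁ x₂)) (flip y₁ y₂ a≢b)
    where
    u : ZN s
    u = x₂ ⊖ x₁
    neg-u≡0 : u ≡ f0 → neg u ≡ f0
    neg-u≡0 z = trans (cong neg z) neg-0
    flat : ∀ y → (x₁ , y) ≢ (x₂ , y) → Even (half (neg u)) ≡ not (Even (half u))
    flat y ne = trans (cong Even (half-neg u)) (Even-neg-half u (ne ∘ cong (_, y) ∘ ⊖≡0⇒≡ x₁ x₂))
    flip : ∀ y₁ y₂ → (x₁ , y₁) ≢ (x₂ , y₂) → orientation y₂ y₁ (neg u) ≡ not (orientation y₁ y₂ u)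
    flip l0 l0 ne = flat l0 ne
    flip l1 l1 ne = cong not (flat l1 ne)
    flip l2 l2 ne = cong not (flat l2 ne)
    flip l0 l1 _ with u FP.≟ f0
    ... | yes z  = trans (cong (not ∘ Even) (neg-u≡0 z)) (cong (not ∘ zeroOrOdd) (sym z))
    ... | no u≢0 = trans (cong not (Even-neg u u≢0)) (cong (λ z → not (z ∨ not (Even u))) (sym (IsZero-≢0 u≢0)))
    flip l1 l0 _ with u FP.≟ f0
    ... | yes z  = trans (cong zeroOrOdd (neg-u≡0 z)) (cong (not ∘ not ∘ Even) (sym z))
    ... | no u≢0 = cong₂ (λ a b → a ∨ not b) (IsZero-≢0 (neg-≢0 u u≢0)) (Even-neg u u≢0)
    flip l0 l2 _ with u FP.≟ f0
    ... | yes z  = trans (cong Even (neg-u≡0 z)) (cong (not ∘ nonzeroEven) (sym z))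
    ... | no u≢0 = trans (Even-neg u u≢0) (cong (λ z → not (not z ∧ Even u)) (sym (IsZero-≢0 u≢0)))
    flip l2 l0 _ with u FP.≟ f0
    ... | yes z  = trans (cong nonzeroEven (neg-u≡0 z)) (cong (not ∘ Even) (sym z))
    ... | no u≢0 = cong₂ (λ a b → not a ∧ b) (IsZero-≢0 (neg-≢0 u u≢0)) (Even-neg u u≢0)
    flip l1 l2 _ with u FP.≟ f0
    ... | yes z  = trans (cong nonzeroEven (neg-u≡0 z)) (cong (not ∘ Even) (sym z))
    ... | no u≢0 = cong₂ (λ a b → not a ∧ b) (IsZero-≢0 (neg-≢0 u u≢0)) (Even-neg u u≢0)
    flip l2 l1 _ with u FP.≟ f0
    ... | yes z  = trans (cong Even (neg-u≡0 z)) (cong (not ∘ nonzeroEven) (sym z))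
    ... | no u≢0 = trans (Even-neg u u≢0) (cong (λ z → not (not z ∧ Even u)) (sym (IsZero-≢0 u≢0)))

  forward-h : ∀ a b → forward (h a) (h b) ≡ forward a b
  forward-h (x₁ , y₁) (x₂ , y₂) = cong (orientation y₁ y₂) (inc-⊖-inc x₂ x₁)

  Oriented : V s → V s → V s → Set
  Oriented a b c = a ≢ b × (c ≡ third a b × T (forward a b) ⊎ c ≡ thirdᵀ a b × T (not (forward a b)))

  rotate-B : ∀ {a b c} → InB a b c → T (forward a b) → InB b c a × T (forward b c)
  rotate-B {a} {b} (a≢b , refl) t = InB-perm (a≢b , refl) p231 , forward-third a b a≢b t

  rotate-Bᵀ : ∀ {a b c} → InBᵀ a b c → T (not (forward a b)) → InBᵀ b c a × T (not (forward b c))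
  rotate-Bᵀ {a} {b} (a≢b , refl) t = InBᵀ-perm (a≢b , refl) p231 , backward-thirdᵀ a b a≢b t

  Oriented⇒Face : ∀ a b c → Oriented a b c → Face s a b c
  Oriented⇒Face a b c (a≢b , inj₁ (e , _)) = Face′⇒Face {a} {b} {c} (a≢b , inj₁ e)
  Oriented⇒Face a b c (a≢b , inj₂ (e , _)) = Face′⇒Face {a} {b} {c} (a≢b , inj₂ e)

  Oriented-rotate : ∀ a b c → Oriented a b c → Oriented b c a
  Oriented-rotate a b c (a≢b , inj₁ (e , t)) with rotate-B (a≢b , e) t
  ... | (b≢c , a≡) , t′ = b≢c , inj₁ (a≡ , t′)
  Oriented-rotate a b c (a≢b , inj₂ (e , t)) with rotate-Bᵀ (a≢b , e) t
  ... | (b≢c , a≡) , t′ = b≢c , inj₂ (a≡ , t′)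

  -- if ab is not forward then ba is, so the triangle is oriented (b, a, c), a rotation of (a, c, b)
  Oriented-total : ∀ a b c → Face s a b c → Oriented a b c ⊎ Oriented a c b
  Oriented-total a b c f = by-kind (Face⇒Face′ {a} {b} {c} f) (forward a b) refl
    where
    by-kind : Face′ a b c → ∀ d → forward a b ≡ d → Oriented a b c ⊎ Oriented a c b
    by-kind (a≢b , inj₁ e) true  ab = inj₁ (a≢b , inj₁ (e , ≡true⇒T ab))
    by-kind (a≢b , inj₂ e) false ab = inj₁ (a≢b , inj₂ (e , ≡false⇒T-not ab))
    by-kind (a≢b , inj₁ e) false ab =
      inj₂ (proj₁ acb , inj₁ (proj₂ acb , subst (λ z → T (forward a z)) (trans (third-comm b a) (sym e))
        (forward-third b a (a≢b ∘ sym) (≡true⇒T (trans (forward-anti a b a≢b) (cong not ab))))))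
      where
      acb : InB a c b
      acb = InB-swap₂₃ (a≢b , e)
    by-kind (a≢b , inj₂ e) true  ab =
      inj₂ (proj₁ acb , inj₂ (proj₂ acb , subst (λ z → T (not (forward a z))) (trans (thirdᵀ-comm b a) (sym e))
        (backward-thirdᵀ b a (a≢b ∘ sym) (≡false⇒T-not (trans (forward-anti a b a≢b) (cong not ab))))))
      where
      acb : InBᵀ a c b
      acb = InBᵀ-perm (a≢b , e) p132

  Oriented-unique : ∀ a b c → Oriented a b c → ¬ Oriented a c b
  Oriented-unique a b c (a≢b , inj₁ (e , t)) (_ , inj₁ (_ , t′)) =
    T-contradiction (proj₂ cab) (subst T (forward-anti c a (proj₁ (proj₁ cab))) t′)
    where
    cab : InB c a b × T (forward c a)
    cab = rotate-B (proj₁ (rotate-B (a≢b , e) t)) (proj₂ (rotate-B (a≢b , e) t))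
  Oriented-unique a b c (a≢b , inj₁ (e , _)) (a≢c , inj₂ (e′ , _)) =
    third≢thirdᵀ 1≤s a b a≢b (trans (sym e) (proj₂ (InBᵀ-perm (a≢c , e′) p132)))
  Oriented-unique a b c (a≢b , inj₂ (e , _)) (a≢c , inj₁ (e′ , _)) =
    third≢thirdᵀ 1≤s a b a≢b (trans (sym (proj₂ (InB-swap₂₃ (a≢c , e′)))) e)
  Oriented-unique a b c (a≢b , inj₂ (e , t)) (_ , inj₂ (_ , t′)) =
    T-contradiction (proj₂ cab) (subst (T ∘ not) (forward-anti c a (proj₁ (proj₁ cab))) t′)
    where
    cab : InBᵀ c a b × T (not (forward c a))
    cab = rotate-Bᵀ (proj₁ (rotate-Bᵀ (a≢b , e) t)) (proj₂ (rotate-Bᵀ (a≢b , e) t))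

  Oriented-coherent : ∀ a b c d → Oriented a b c → Oriented a b d → c ≡ d
  Oriented-coherent a b c d (_ , inj₁ (e , _)) (_ , inj₁ (e′ , _)) = trans e (sym e′)
  Oriented-coherent a b c d (_ , inj₂ (e , _)) (_ , inj₂ (e′ , _)) = trans e (sym e′)
  Oriented-coherent a b c d (_ , inj₁ (_ , t)) (_ , inj₂ (_ , t′)) = ⊥-elim (T-contradiction t t′)
  Oriented-coherent a b c d (_ , inj₂ (_ , t)) (_ , inj₁ (_ , t′)) = ⊥-elim (T-contradiction t′ t)

  Oriented-h : ∀ a b c → Oriented a b c → Oriented (h a) (h b) (h c)
  Oriented-h a b c (a≢b , inj₁ (e , t)) =
    a≢b ∘ h-injective , inj₁ (trans (cong h e) (sym (third-h a b)) , subst T (sym (forward-h a b)) t)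
  Oriented-h a b c (a≢b , inj₂ (e , t)) =
    a≢b ∘ h-injective , inj₂ (trans (cong h e) (sym (thirdᵀ-h a b)) , subst (T ∘ not) (sym (forward-h a b)) t)

  h-orientationPreserving : OrientationPreserving s h
  h-orientationPreserving =
    Oriented , (Oriented⇒Face , Oriented-rotate , Oriented-total , Oriented-unique , Oriented-coherent) , Oriented-h

mainTheorem10 : (s : ℕ) → 2 ≤ s → 2 ∣ s →
    (genus s ≡ (s * (6 * s ∸ 1)) / 2)
    × chi1Is s (3 * (2 * s + 1))
    × chi2Is s 3
    × IsAutomorphism s (hshift s)
    × OrientationPreserving s (hshift s)
mainTheorem10 s 2≤s _ = genus≡ , chi1 , chi2 , h-isAutomorphism , h-orientationPreserving
  where
  1≤s : 1 ≤ s
  1≤s = ≤-trans (s≤s z≤n) 2≤s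
  open Counting s 1≤s
  open Shift s
  open Orientation s 1≤s
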